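{- (Subject reduction.) Let $g:\mathbb N\to\mathbb N$ satisfy $h<g(h)$ for all $h$. For every environment $C$ and terms $T,T_1,T_2$: if $C\vdash T\to^*T_1$ and $C\vdash_g T:T_2$, then $C\vdash_g T_1:T_2$.
   Context: Terms of $\lambda\delta$: $T ::= \ast h \mid x \mid \lambda x{:}W.\,T \mid \delta x{=}V.\,T \mid \mathrm{appl}(V,T) \mid \mathrm{cast}(W,T)$ ($h\in\mathbb N$, $x$ a variable); $\ast h$ is a sort, $\lambda x{:}W.T$ abstraction over type $W$, $\delta x{=}V.T$ the abbreviation "let $x=V$ in $T$", $\mathrm{appl}(V,T)$ application of $T$ to argument $V$, $\mathrm{cast}(W,T)$ $T$ annotated with type $W$. In $\lambda x{:}W.T$, $\delta x{=}V.T$, $x$ is bound in $T$ only; $\mathrm{FV}(T)$ free variables; terms up to renaming of bound variables with bound and free names disjoint. Environments: $E ::= \ast h \mid \lambda x{:}W.E \mid \delta x{=}V.E \mid \mathrm{appl}(V,E)\mid\mathrm{cast}(W,E)$. $E.\lambda x{:}W$ (resp. $E.\delta x{=}V$) is $E$ with its terminal sort $\ast h$ replaced by $\lambda x{:}W.\ast h$ (resp. $\delta x{=}V.\ast h$). $E=C_1\cdot\beta\cdot C_2$, for an item $\beta$ of the form $\lambda x{:}W$ or $\delta x{=}V$, means $E$ is obtained from the environment $C_1$ by replacing its terminal sort with $\beta.C_2$ for some environment $C_2$. Strict substitution: $T[x:=^+W]\,T'$ iff $x\notin\mathrm{FV}(W)$, $x\in\mathrm{FV}(T)$ and $T'$ arises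 from $T$ by replacing a nonempty set of free occurrences of $x$ by $W$. Environment-free parallel reduction $\to_0$: least relation closed under (refl) $T\to_0T$; (compatibility) if $A_1\to_0A_2$, $T_1\to_0T_2$ then $\lambda x{:}A_1.T_1\to_0\lambda x{:}A_2.T_2$, $\delta x{=}A_1.T_1\to_0\delta x{=}A_2.T_2$, $\mathrm{appl}(A_1,T_1)\to_0\mathrm{appl}(A_2,T_2)$, $\mathrm{cast}(A_1,T_1)\to_0\mathrm{cast}(A_2,T_2)$; ($\beta$) if $V_1\to_0V_2$, $T_1\to_0T_2$ then $\mathrm{appl}(V_1,\lambda x{:}W.T_1)\to_0\delta x{=}V_2.T_2$; ($\delta$) if $V_1\to_0V_2$, $T_1\to_0T_2$, $T_2[x:=^+V_2]T$ then $\delta x{=}V_1.T_1\to_0\delta x{=}V_2.T$; ($\zeta$) if $T_1\to_0T_2$, $x\notin\mathrm{FV}(T_1)$ then $\delta x{=}V.T_1\to_0T_2$; ($\tau$) if $T_1\to_0T_2$ then $\mathrm{cast}(W,T_1)\to_0T_2$; ($\upsilon$) if $V_1\to_0V_3$, $V_2\to_0V_4$, $T_1\to_0T_2$ then $\mathrm{appl}(V_1,\delta x{=}V_2.T_1)\to_0\delta x{=}V_4.\mathrm{appl}(V_3,T_2)$. $E\vdash T_1\to T_2$ iff $T_1\to_0T_2$, or $E=C_1\cdot\delta x{=}V\cdot C_2$, $T_1\to_0T'$, $T'[x:=^+V]T_2$. $E\vdash T_1\to^*T_2$ is its transitive closure; conversion $E\vdash T_1\Leftrightarrow T_2$ is its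 symmetric and transitive closure. Native type assignment $E\vdash_g T:U$ is the least relation closed under: (sort) $E\vdash_g\ast h:\ast g(h)$; (def) if $E=C_1\cdot\delta x{=}V\cdot C_2$ and $C_1\vdash_g V:W$ then $E\vdash_g x:W$; (decl) if $E=C_1\cdot\lambda x{:}W\cdot C_2$ and $C_1\vdash_g W:V$ then $E\vdash_g x:W$; (abbr) if $E\vdash_g V:W$ and $E.\delta x{=}V\vdash_g T:U$ then $E\vdash_g\delta x{=}V.T:\delta x{=}V.U$; (abst) if $E\vdash_g W:V$ and $E.\lambda x{:}W\vdash_g T:U$ then $E\vdash_g\lambda x{:}W.T:\lambda x{:}W.U$; (appl) if $E\vdash_g V:W$ and $E\vdash_g T:\lambda x{:}W.U$ then $E\vdash_g\mathrm{appl}(V,T):\mathrm{appl}(V,\lambda x{:}W.U)$; (cast) if $E\vdash_g T:W$ and $E\vdash_g W:V$ then $E\vdash_g\mathrm{cast}(W,T):\mathrm{cast}(V,W)$; (conv) if $E\vdash_g U_2:W$, $E\vdash_g T:U_1$ and $E\vdash U_1\Leftrightarrow U_2$ then $E\vdash_g T:U_2$. -}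

module Defs where

open import Data.Nat using (ℕ; zero; suc; _+_; _<_; _<ᵇ_)
open import Data.Bool using (if_then_else_)

-- Terms of λδ, with de Bruijn indices (index 0 = innermost binder).
-- This realises "terms up to renaming of bound variables".

data Term : Set where
  sort : ℕ → Term
  lref : ℕ → Term
  abst : Term → Term → Term       -- λx:W.T   (abst W T, binds in T)
  abbr : Term → Term → Term       -- δx=V.T   (abbr V T, binds in T)
  appl : Term → Term → Term
  cast : Term → Term → Term

lift : ℕ → ℕ → Term → Term
lift d k (sort h)   = sort h
lift d k (lref i)   = if i <ᵇ d then lref i else lref (k + i)
lift d k (abst W T) = abst (lift d k W) (lift (suc d) k T)
lift d k (abbr V T) = abbr (lift d k V) (lift (suc d) k T)
lift d k (appl V T) = appl (lift d k V) (lift d k T)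
lift d k (cast W T) = cast (lift d k W) (lift d k T)

-- Subst i V T T' : T' arises from T by replacing a (possibly empty) set of
--   free occurrences of variable i by V (V given in the scope of T; it is
--   lifted when going under binders).

data Subst : ℕ → Term → Term → Term → Set where
  s-keep : ∀ {i V T} → Subst i V T T
  s-here : ∀ {i V} → Subst i V (lref i) V
  s-abst : ∀ {i V W W' T T'} → Subst i V W W' → Subst (suc i) (lift 0 1 V) T T' →
           Subst i V (abst W T) (abst W' T')
  s-abbr : ∀ {i V W W' T T'} → Subst i V W W' → Subst (suc i) (lift 0 1 V) T T' →
           Subst i V (abbr W T) (abbr W' T')
  s-appl : ∀ {i V W W' T T'} → Subst i V W W' → Subst i V T T' →
           Subst i V (appl W T) (appl W' T')
  s-cast : ∀ {i V W W' T T'} → Subst i V W W' → Subst i V T T' →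
           Subst i V (cast W T) (cast W' T')

data SubstS : ℕ → Term → Term → Term → Set where
  ss-here  : ∀ {i V} → SubstS i V (lref i) V
  ss-abst₁ : ∀ {i V W W' T T'} → SubstS i V W W' → Subst (suc i) (lift 0 1 V) T T' →
             SubstS i V (abst W T) (abst W' T')
  ss-abst₂ : ∀ {i V W W' T T'} → Subst i V W W' → SubstS (suc i) (lift 0 1 V) T T' →
             SubstS i V (abst W T) (abst W' T')
  ss-abbr₁ : ∀ {i V W W' T T'} → SubstS i V W W' → Subst (suc i) (lift 0 1 V) T T' →
             SubstS i V (abbr W T) (abbr W' T')
  ss-abbr₂ : ∀ {i V W W' T T'} → Subst i V W W' → SubstS (suc i) (lift 0 1 V) T T' →
             SubstS i V (abbr W T) (abbr W' T')
  ss-appl₁ : ∀ {i V W W' T T'} → SubstS i V W W' → Subst i V T T' →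
             SubstS i V (appl W T) (appl W' T')
  ss-appl₂ : ∀ {i V W W' T T'} → Subst i V W W' → SubstS i V T T' →
             SubstS i V (appl W T) (appl W' T')
  ss-cast₁ : ∀ {i V W W' T T'} → SubstS i V W W' → Subst i V T T' →
             SubstS i V (cast W T) (cast W' T')
  ss-cast₂ : ∀ {i V W W' T T'} → Subst i V W W' → SubstS i V T T' →
             SubstS i V (cast W T) (cast W' T')

-- Environments (outermost item first, terminated by a sort).

data Env : Set where
  esort : ℕ → Env
  eabst : Term → Env → Env
  eabbr : Term → Env → Env
  eappl : Term → Env → Env
  ecast : Term → Env → Env

data Item : Set where
  iabst : Term → Item
  iabbr : Term → Item

_∙_ : Item → Env → Env
iabst W ∙ C = eabst W C
iabbr V ∙ C = eabbr V C

_▸_ : Env → Item → Env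
esort h   ▸ β = β ∙ esort h
eabst W E ▸ β = eabst W (E ▸ β)
eabbr V E ▸ β = eabbr V (E ▸ β)
eappl V E ▸ β = eappl V (E ▸ β)
ecast W E ▸ β = ecast W (E ▸ β)

binders : Env → ℕ
binders (esort h)   = 0
binders (eabst W E) = suc (binders E)
binders (eabbr V E) = suc (binders E)
binders (eappl V E) = binders E
binders (ecast W E) = binders E

-- Split E C₁ β n  :  E = C₁ · β · C₂ for some C₂ with n = binders C₂;
-- the variable bound by β is then the de Bruijn index n in E.
data Split : Env → Env → Item → ℕ → Set where
  sp-here : ∀ {h β C₂} → Split (β ∙ C₂) (esort h) β (binders C₂)
  sp-abst : ∀ {E C₁ β n W} → Split E C₁ β n → Split (eabst W E) (eabst W C₁) β n
  sp-abbr : ∀ {E C₁ β n V} → Split E C₁ β n → Split (eabbr V E) (eabbr V C₁) β n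
  sp-appl : ∀ {E C₁ β n V} → Split E C₁ β n → Split (eappl V E) (eappl V C₁) β n
  sp-cast : ∀ {E C₁ β n W} → Split E C₁ β n → Split (ecast W E) (ecast W C₁) β n

infix 4 _⇒₀_
data _⇒₀_ : Term → Term → Set where
  r-refl : ∀ {T} → T ⇒₀ T
  r-abst : ∀ {A₁ A₂ T₁ T₂} → A₁ ⇒₀ A₂ → T₁ ⇒₀ T₂ → abst A₁ T₁ ⇒₀ abst A₂ T₂
  r-abbr : ∀ {A₁ A₂ T₁ T₂} → A₁ ⇒₀ A₂ → T₁ ⇒₀ T₂ → abbr A₁ T₁ ⇒₀ abbr A₂ T₂
  r-appl : ∀ {A₁ A₂ T₁ T₂} → A₁ ⇒₀ A₂ → T₁ ⇒₀ T₂ → appl A₁ T₁ ⇒₀ appl A₂ T₂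
  r-cast : ∀ {A₁ A₂ T₁ T₂} → A₁ ⇒₀ A₂ → T₁ ⇒₀ T₂ → cast A₁ T₁ ⇒₀ cast A₂ T₂
  r-beta : ∀ {V₁ V₂ W T₁ T₂} → V₁ ⇒₀ V₂ → T₁ ⇒₀ T₂ →
           appl V₁ (abst W T₁) ⇒₀ abbr V₂ T₂
  r-delta : ∀ {V₁ V₂ T₁ T₂ T} → V₁ ⇒₀ V₂ → T₁ ⇒₀ T₂ → SubstS 0 (lift 0 1 V₂) T₂ T →
            abbr V₁ T₁ ⇒₀ abbr V₂ T
  -- (ζ) δx=V.T₁ →₀ T₂ with x ∉ FV(T₁)  (T₁ is the lifting of a term)
  r-zeta : ∀ {V T₁ T₂} → T₁ ⇒₀ T₂ → abbr V (lift 0 1 T₁) ⇒₀ T₂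
  r-tau : ∀ {W T₁ T₂} → T₁ ⇒₀ T₂ → cast W T₁ ⇒₀ T₂
  r-upsilon : ∀ {V₁ V₂ V₃ V₄ T₁ T₂} → V₁ ⇒₀ V₃ → V₂ ⇒₀ V₄ → T₁ ⇒₀ T₂ →
              appl V₁ (abbr V₂ T₁) ⇒₀ abbr V₄ (appl (lift 0 1 V₃) T₂)

data _⊢_⇒_ : Env → Term → Term → Set where
  e-free : ∀ {E T₁ T₂} → T₁ ⇒₀ T₂ → E ⊢ T₁ ⇒ T₂
  e-delta : ∀ {E C₁ V n T₁ T' T₂} → Split E C₁ (iabbr V) n →
            T₁ ⇒₀ T' → SubstS n (lift 0 (suc n) V) T' T₂ → E ⊢ T₁ ⇒ T₂

data _⊢_⇒*_ : Env → Term → Term → Set where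
  st-one  : ∀ {E T₁ T₂} → E ⊢ T₁ ⇒ T₂ → E ⊢ T₁ ⇒* T₂
  st-step : ∀ {E T₁ T₂ T₃} → E ⊢ T₁ ⇒ T₂ → E ⊢ T₂ ⇒* T₃ → E ⊢ T₁ ⇒* T₃

data _⊢_⇔_ : Env → Term → Term → Set where
  cv-step  : ∀ {E T₁ T₂} → E ⊢ T₁ ⇒ T₂ → E ⊢ T₁ ⇔ T₂
  cv-sym   : ∀ {E T₁ T₂} → E ⊢ T₁ ⇔ T₂ → E ⊢ T₂ ⇔ T₁
  cv-trans : ∀ {E T₁ T₂ T₃} → E ⊢ T₁ ⇔ T₂ → E ⊢ T₂ ⇔ T₃ → E ⊢ T₁ ⇔ T₃

data _⊢[_]_∶_ : Env → (ℕ → ℕ) → Term → Term → Set where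
  t-sort : ∀ {E g h} → E ⊢[ g ] sort h ∶ sort (g h)
  t-def  : ∀ {E g C₁ V W n} → Split E C₁ (iabbr V) n → C₁ ⊢[ g ] V ∶ W →
           E ⊢[ g ] lref n ∶ lift 0 (suc n) W
  t-decl : ∀ {E g C₁ W V n} → Split E C₁ (iabst W) n → C₁ ⊢[ g ] W ∶ V →
           E ⊢[ g ] lref n ∶ lift 0 (suc n) W
  t-abbr : ∀ {E g V W T U} → E ⊢[ g ] V ∶ W → (E ▸ iabbr V) ⊢[ g ] T ∶ U →
           E ⊢[ g ] abbr V T ∶ abbr V U
  t-abst : ∀ {E g W V T U} → E ⊢[ g ] W ∶ V → (E ▸ iabst W) ⊢[ g ] T ∶ U →
           E ⊢[ g ] abst W T ∶ abst W U
  t-appl : ∀ {E g V W T U} → E ⊢[ g ] V ∶ W → E ⊢[ g ] T ∶ abst W U →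
           E ⊢[ g ] appl V T ∶ appl V (abst W U)
  t-cast : ∀ {E g T W V} → E ⊢[ g ] T ∶ W → E ⊢[ g ] W ∶ V →
           E ⊢[ g ] cast W T ∶ cast V W
  t-conv : ∀ {E g T U₁ U₂ W} → E ⊢[ g ] U₂ ∶ W → E ⊢[ g ] T ∶ U₁ → E ⊢ U₁ ⇔ U₂ →
           E ⊢[ g ] T ∶ U₂

{-# OPTIONS --safe #-}
-- Subject reduction is shown for one step of →₀, and for one δ-expansion of an abbreviation
-- of the environment, by induction on the typing derivation: (conv) commutes with both, and
-- each contractum gets a type convertible to the old one, which validity lets us restore.
-- The contracta are typed with three structural facts: thinning; deletion of an abbreviation
-- δx=V by substituting V for x (the ζ-rule); and replacement of an environment item by one
-- that gives its variable the same types, as when a definiens reduces or a β-redex turns the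
-- declaration λx:W into δx=V.  The β-case also needs λx:W.U ⇔ λx:W′.U′ to imply
-- W ⇔ W′ and U ⇔ U′.  Expanding every abbreviation, of the term and of the environment, and
-- erasing casts maps conversion into β-conversion of pure terms, which is Church–Rosser by
-- the Tait–Martin-Löf method; as every term is convertible to its expansion, injectivity
-- transfers back.
module Submission where

open import Defs
open import Data.Bool using (true; false; if_then_else_)
open import Data.Empty using (⊥-elim)
open import Data.Nat using (ℕ; zero; suc; _+_; _<_; _≤_; _<ᵇ_; z≤n; s≤s; _<?_)
open import Data.Nat.Induction using (<-wellFounded)
open import Data.Nat.Properties
  using (+-suc; +-comm; +-assoc; +-identityʳ; _≟_; m+1+n≢n; ≤-trans; ≤-refl; ≤-reflexive; n≤1+n; m≤m+n;
         m≤n⇒m≤1+n; +-monoʳ-<; +-monoʳ-≤; ≮⇒≥; <ᵇ⇒<; <⇒<ᵇ; ≤⇒≯)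
open import Data.Product using (∃-syntax; _×_; _,_; proj₁; proj₂)
open import Data.Sum using (_⊎_; inj₁; inj₂)
open import Function using (_∘_; id)
open import Induction.WellFounded using (Acc; acc)
open import Relation.Binary.PropositionalEquality
open import Relation.Nullary using (¬_; yes; no; contradiction)

private variable
  g : ℕ → ℕ
  d e h h₁ i j k m n : ℕ
  A A′ B B′ T T′ T₁ T₂ U U′ U₁ V V′ W W′ X : Term
  C C₁ D D₁ E E₁ : Env
  β γ : Item

Ren : Set
Ren = ℕ → ℕ

ext : Ren → Ren
ext ρ zero    = zero
ext ρ (suc i) = suc (ρ i)

rename : Ren → Term → Term
rename ρ (sort h)   = sort h
rename ρ (lref i)   = lref (ρ i)
rename ρ (abst W T) = abst (rename ρ W) (rename (ext ρ) T)
rename ρ (abbr V T) = abbr (rename ρ V) (rename (ext ρ) T)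
rename ρ (appl V T) = appl (rename ρ V) (rename ρ T)
rename ρ (cast W T) = cast (rename ρ W) (rename ρ T)

ext-cong : ∀ {ρ ρ₁} → ρ ≗ ρ₁ → ext ρ ≗ ext ρ₁
ext-cong eq zero    = refl
ext-cong eq (suc i) = cong suc (eq i)

rename-cong : ∀ {ρ ρ₁} → ρ ≗ ρ₁ → ∀ T → rename ρ T ≡ rename ρ₁ T
rename-cong eq (sort h)   = refl
rename-cong eq (lref i)   = cong lref (eq i)
rename-cong eq (abst W T) = cong₂ abst (rename-cong eq W) (rename-cong (ext-cong eq) T)
rename-cong eq (abbr V T) = cong₂ abbr (rename-cong eq V) (rename-cong (ext-cong eq) T)
rename-cong eq (appl V T) = cong₂ appl (rename-cong eq V) (rename-cong eq T)
rename-cong eq (cast W T) = cong₂ cast (rename-cong eq W) (rename-cong eq T)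

ext-∘ : ∀ ρ ρ₁ → ext ρ ∘ ext ρ₁ ≗ ext (ρ ∘ ρ₁)
ext-∘ ρ ρ₁ zero    = refl
ext-∘ ρ ρ₁ (suc i) = refl

rename-∘ : ∀ ρ ρ₁ T → rename ρ (rename ρ₁ T) ≡ rename (ρ ∘ ρ₁) T
rename-∘ ρ ρ₁ (sort h)   = refl
rename-∘ ρ ρ₁ (lref i)   = refl
rename-∘ ρ ρ₁ (abst W T) =
  cong₂ abst (rename-∘ ρ ρ₁ W) (trans (rename-∘ (ext ρ) (ext ρ₁) T) (rename-cong (ext-∘ ρ ρ₁) T))
rename-∘ ρ ρ₁ (abbr V T) =
  cong₂ abbr (rename-∘ ρ ρ₁ V) (trans (rename-∘ (ext ρ) (ext ρ₁) T) (rename-cong (ext-∘ ρ ρ₁) T))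
rename-∘ ρ ρ₁ (appl V T) = cong₂ appl (rename-∘ ρ ρ₁ V) (rename-∘ ρ ρ₁ T)
rename-∘ ρ ρ₁ (cast W T) = cong₂ cast (rename-∘ ρ ρ₁ W) (rename-∘ ρ ρ₁ T)

ext-id : ext id ≗ id
ext-id zero    = refl
ext-id (suc i) = refl

rename-id : ∀ T → rename id T ≡ T
rename-id (sort h)   = refl
rename-id (lref i)   = refl
rename-id (abst W T) = cong₂ abst (rename-id W) (trans (rename-cong ext-id T) (rename-id T))
rename-id (abbr V T) = cong₂ abbr (rename-id V) (trans (rename-cong ext-id T) (rename-id T))
rename-id (appl V T) = cong₂ appl (rename-id V) (rename-id T)
rename-id (cast W T) = cong₂ cast (rename-id W) (rename-id T)

Sub : Set
Sub = ℕ → Term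

exts : Sub → Sub
exts σ zero    = lref zero
exts σ (suc i) = rename suc (σ i)

sub : Sub → Term → Term
sub σ (sort h)   = sort h
sub σ (lref i)   = σ i
sub σ (abst W T) = abst (sub σ W) (sub (exts σ) T)
sub σ (abbr V T) = abbr (sub σ V) (sub (exts σ) T)
sub σ (appl V T) = appl (sub σ V) (sub σ T)
sub σ (cast W T) = cast (sub σ W) (sub σ T)

exts-cong : ∀ {σ τ} → σ ≗ τ → exts σ ≗ exts τ
exts-cong eq zero    = refl
exts-cong eq (suc i) = cong (rename suc) (eq i)

sub-cong : ∀ {σ τ} → σ ≗ τ → ∀ T → sub σ T ≡ sub τ T
sub-cong eq (sort h)   = refl
sub-cong eq (lref i)   = eq i
sub-cong eq (abst W T) = cong₂ abst (sub-cong eq W) (sub-cong (exts-cong eq) T)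
sub-cong eq (abbr V T) = cong₂ abbr (sub-cong eq V) (sub-cong (exts-cong eq) T)
sub-cong eq (appl V T) = cong₂ appl (sub-cong eq V) (sub-cong eq T)
sub-cong eq (cast W T) = cong₂ cast (sub-cong eq W) (sub-cong eq T)

lref-ext : ∀ ρ → lref ∘ ext ρ ≗ exts (lref ∘ ρ)
lref-ext ρ zero    = refl
lref-ext ρ (suc i) = refl

rename-as-sub : ∀ ρ T → rename ρ T ≡ sub (lref ∘ ρ) T
rename-as-sub ρ (sort h)   = refl
rename-as-sub ρ (lref i)   = refl
rename-as-sub ρ (abst W T) =
  cong₂ abst (rename-as-sub ρ W) (trans (rename-as-sub (ext ρ) T) (sub-cong (lref-ext ρ) T))
rename-as-sub ρ (abbr V T) =
  cong₂ abbr (rename-as-sub ρ V) (trans (rename-as-sub (ext ρ) T) (sub-cong (lref-ext ρ) T))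
rename-as-sub ρ (appl V T) = cong₂ appl (rename-as-sub ρ V) (rename-as-sub ρ T)
rename-as-sub ρ (cast W T) = cong₂ cast (rename-as-sub ρ W) (rename-as-sub ρ T)

sub-id : ∀ T → sub lref T ≡ T
sub-id T = trans (sym (rename-as-sub id T)) (rename-id T)

exts-ext : ∀ σ ρ → exts σ ∘ ext ρ ≗ exts (σ ∘ ρ)
exts-ext σ ρ zero    = refl
exts-ext σ ρ (suc i) = refl

sub-rename : ∀ σ ρ T → sub σ (rename ρ T) ≡ sub (σ ∘ ρ) T
sub-rename σ ρ (sort h)   = refl
sub-rename σ ρ (lref i)   = refl
sub-rename σ ρ (abst W T) =
  cong₂ abst (sub-rename σ ρ W) (trans (sub-rename (exts σ) (ext ρ) T) (sub-cong (exts-ext σ ρ) T))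
sub-rename σ ρ (abbr V T) =
  cong₂ abbr (sub-rename σ ρ V) (trans (sub-rename (exts σ) (ext ρ) T) (sub-cong (exts-ext σ ρ) T))
sub-rename σ ρ (appl V T) = cong₂ appl (sub-rename σ ρ V) (sub-rename σ ρ T)
sub-rename σ ρ (cast W T) = cong₂ cast (sub-rename σ ρ W) (sub-rename σ ρ T)

rename-exts : ∀ ρ σ → rename (ext ρ) ∘ exts σ ≗ exts (rename ρ ∘ σ)
rename-exts ρ σ zero    = refl
rename-exts ρ σ (suc i) = trans (rename-∘ (ext ρ) suc (σ i)) (sym (rename-∘ suc ρ (σ i)))

rename-sub : ∀ ρ σ T → rename ρ (sub σ T) ≡ sub (rename ρ ∘ σ) T
rename-sub ρ σ (sort h)   = refl
rename-sub ρ σ (lref i)   = refl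
rename-sub ρ σ (abst W T) =
  cong₂ abst (rename-sub ρ σ W) (trans (rename-sub (ext ρ) (exts σ) T) (sub-cong (rename-exts ρ σ) T))
rename-sub ρ σ (abbr V T) =
  cong₂ abbr (rename-sub ρ σ V) (trans (rename-sub (ext ρ) (exts σ) T) (sub-cong (rename-exts ρ σ) T))
rename-sub ρ σ (appl V T) = cong₂ appl (rename-sub ρ σ V) (rename-sub ρ σ T)
rename-sub ρ σ (cast W T) = cong₂ cast (rename-sub ρ σ W) (rename-sub ρ σ T)

sub-exts : ∀ σ τ → sub (exts σ) ∘ exts τ ≗ exts (sub σ ∘ τ)
sub-exts σ τ zero    = refl
sub-exts σ τ (suc i) = trans (sub-rename (exts σ) suc (τ i)) (sym (rename-sub suc σ (τ i)))

sub-sub : ∀ σ τ T → sub σ (sub τ T) ≡ sub (sub σ ∘ τ) T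
sub-sub σ τ (sort h)   = refl
sub-sub σ τ (lref i)   = refl
sub-sub σ τ (abst W T) =
  cong₂ abst (sub-sub σ τ W) (trans (sub-sub (exts σ) (exts τ) T) (sub-cong (sub-exts σ τ) T))
sub-sub σ τ (abbr V T) =
  cong₂ abbr (sub-sub σ τ V) (trans (sub-sub (exts σ) (exts τ) T) (sub-cong (sub-exts σ τ) T))
sub-sub σ τ (appl V T) = cong₂ appl (sub-sub σ τ V) (sub-sub σ τ T)
sub-sub σ τ (cast W T) = cong₂ cast (sub-sub σ τ W) (sub-sub σ τ T)

sub-exts-rename-suc : ∀ σ T → sub (exts σ) (rename suc T) ≡ rename suc (sub σ T)
sub-exts-rename-suc σ T = trans (sub-rename (exts σ) suc T) (sym (rename-sub suc σ T))

rename-+-suc : ∀ b T → rename (b +_) (rename suc T) ≡ rename (suc b +_) T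
rename-+-suc b T = trans (rename-∘ (b +_) suc T) (rename-cong (+-suc b) T)

-- (d ≔ V) replaces index d by V and closes the gap above it.
infix 5 _≔_

_≔_ : ℕ → Term → Sub
(zero ≔ V) zero    = V
(zero ≔ V) (suc i) = lref i
(suc d ≔ V)        = exts (d ≔ V)

rename-≔₀ : ∀ ρ V T → rename ρ (sub (0 ≔ V) T) ≡ sub (0 ≔ rename ρ V) (rename (ext ρ) T)
rename-≔₀ ρ V T = begin
  rename ρ (sub (0 ≔ V) T)                  ≡⟨ rename-sub ρ (0 ≔ V) T ⟩
  sub (rename ρ ∘ (0 ≔ V)) T                ≡⟨ sub-cong pointwise T ⟩
  sub ((0 ≔ rename ρ V) ∘ ext ρ) T          ≡⟨ sub-rename (0 ≔ rename ρ V) (ext ρ) T ⟨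
  sub (0 ≔ rename ρ V) (rename (ext ρ) T)   ∎
  where
  open ≡-Reasoning
  pointwise : rename ρ ∘ (0 ≔ V) ≗ (0 ≔ rename ρ V) ∘ ext ρ
  pointwise zero    = refl
  pointwise (suc i) = refl

sub-≔₀ : ∀ σ V T → sub σ (sub (0 ≔ V) T) ≡ sub (0 ≔ sub σ V) (sub (exts σ) T)
sub-≔₀ σ V T = begin
  sub σ (sub (0 ≔ V) T)                ≡⟨ sub-sub σ (0 ≔ V) T ⟩
  sub (sub σ ∘ (0 ≔ V)) T              ≡⟨ sub-cong pointwise T ⟩
  sub (sub (0 ≔ sub σ V) ∘ exts σ) T   ≡⟨ sub-sub (0 ≔ sub σ V) (exts σ) T ⟨
  sub (0 ≔ sub σ V) (sub (exts σ) T)   ∎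
  where
  open ≡-Reasoning
  pointwise : sub σ ∘ (0 ≔ V) ≗ sub (0 ≔ sub σ V) ∘ exts σ
  pointwise zero    = refl
  pointwise (suc i) = sym (trans (sub-rename (0 ≔ sub σ V) suc (σ i)) (sub-id (σ i)))

liftVar : ℕ → ℕ → Ren
liftVar d k i = if i <ᵇ d then i else k + i

liftVar-suc : ∀ d k → liftVar (suc d) k ≗ ext (liftVar d k)
liftVar-suc d k zero = refl
liftVar-suc d k (suc i) with i <ᵇ d
... | true  = refl
... | false = +-suc k i

liftVar-below : ∀ k → i < d → liftVar d k i ≡ i
liftVar-below {i} {d} k i<d with i <ᵇ d | <⇒<ᵇ i<d
... | true | _ = refl

liftVar-above : ∀ k → d ≤ i → liftVar d k i ≡ k + i
liftVar-above {d} {i} k d≤i with i <ᵇ d | <ᵇ⇒< i d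
... | false | _   = refl
... | true  | i<d = contradiction (i<d _) (≤⇒≯ d≤i)

lift-lref : ∀ d k i → lift d k (lref i) ≡ lref (liftVar d k i)
lift-lref d k i with i <ᵇ d
... | true  = refl
... | false = refl

lift≡rename : ∀ d k T → lift d k T ≡ rename (liftVar d k) T
lift≡rename d k (sort h)   = refl
lift≡rename d k (lref i)   = lift-lref d k i
lift≡rename d k (abst W T) =
  cong₂ abst (lift≡rename d k W) (trans (lift≡rename (suc d) k T) (rename-cong (liftVar-suc d k) T))
lift≡rename d k (abbr V T) =
  cong₂ abbr (lift≡rename d k V) (trans (lift≡rename (suc d) k T) (rename-cong (liftVar-suc d k) T))
lift≡rename d k (appl V T) = cong₂ appl (lift≡rename d k V) (lift≡rename d k T)
lift≡rename d k (cast W T) = cong₂ cast (lift≡rename d k W) (lift≡rename d k T)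

lift≡sub : ∀ d k T → lift d k T ≡ sub (lref ∘ liftVar d k) T
lift≡sub d k T = trans (lift≡rename d k T) (rename-as-sub (liftVar d k) T)

lift₀≡rename : ∀ k T → lift 0 k T ≡ rename (k +_) T
lift₀≡rename = lift≡rename 0

lift₀≡sub : ∀ k T → lift 0 k T ≡ sub (lref ∘ (k +_)) T
lift₀≡sub = lift≡sub 0

lift₀-lift₀ : ∀ a b V → lift 0 a (lift 0 b V) ≡ lift 0 (a + b) V
lift₀-lift₀ a b V = begin
  lift 0 a (lift 0 b V)             ≡⟨ lift₀≡rename a _ ⟩
  rename (a +_) (lift 0 b V)        ≡⟨ cong (rename (a +_)) (lift₀≡rename b V) ⟩
  rename (a +_) (rename (b +_) V)   ≡⟨ rename-∘ (a +_) (b +_) V ⟩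
  rename ((a +_) ∘ (b +_)) V        ≡⟨ rename-cong (λ i → +-assoc a b i) V ⟨
  rename (a + b +_) V               ≡⟨ lift₀≡rename (a + b) V ⟨
  lift 0 (a + b) V                  ∎
  where open ≡-Reasoning

lift₁-lift₀ : ∀ k V → lift 0 1 (lift 0 k V) ≡ lift 0 (suc k) V
lift₁-lift₀ = lift₀-lift₀ 1

sub-exts-lift₁ : ∀ σ X → sub (exts σ) (lift 0 1 X) ≡ lift 0 1 (sub σ X)
sub-exts-lift₁ σ X = begin
  sub (exts σ) (lift 0 1 X)      ≡⟨ cong (sub (exts σ)) (lift₀≡rename 1 X) ⟩
  sub (exts σ) (rename suc X)    ≡⟨ sub-exts-rename-suc σ X ⟩
  rename suc (sub σ X)           ≡⟨ lift₀≡rename 1 _ ⟨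
  lift 0 1 (sub σ X)             ∎
  where open ≡-Reasoning

≔₀-lift₁ : ∀ V T → sub (0 ≔ V) (lift 0 1 T) ≡ T
≔₀-lift₁ V T = trans (cong (sub (0 ≔ V)) (lift₀≡rename 1 T)) (trans (sub-rename (0 ≔ V) suc T) (sub-id T))

lift-lift₀-≤ : ∀ {a} k W → d ≤ a → lift d k (lift 0 a W) ≡ lift 0 (k + a) W
lift-lift₀-≤ {d} {a} k W d≤a = begin
  lift d k (lift 0 a W)                 ≡⟨ lift≡rename d k _ ⟩
  rename (liftVar d k) (lift 0 a W)     ≡⟨ cong (rename (liftVar d k)) (lift₀≡rename a W) ⟩
  rename (liftVar d k) (rename (a +_) W) ≡⟨ rename-∘ (liftVar d k) (a +_) W ⟩
  rename (liftVar d k ∘ (a +_)) W       ≡⟨ rename-cong pointwise W ⟩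
  rename (k + a +_) W                   ≡⟨ lift₀≡rename (k + a) W ⟨
  lift 0 (k + a) W                      ∎
  where
  open ≡-Reasoning
  pointwise : ∀ j → liftVar d k (a + j) ≡ k + a + j
  pointwise j = trans (liftVar-above k (≤-trans d≤a (m≤m+n a j))) (sym (+-assoc k a j))

lift-lift₀-comm : ∀ a e k W → lift (a + e) k (lift 0 a W) ≡ lift 0 a (lift e k W)
lift-lift₀-comm a e k W = begin
  lift (a + e) k (lift 0 a W)                   ≡⟨ lift≡rename (a + e) k _ ⟩
  rename (liftVar (a + e) k) (lift 0 a W)       ≡⟨ cong (rename (liftVar (a + e) k)) (lift₀≡rename a W) ⟩
  rename (liftVar (a + e) k) (rename (a +_) W)  ≡⟨ rename-∘ (liftVar (a + e) k) (a +_) W ⟩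
  rename (liftVar (a + e) k ∘ (a +_)) W         ≡⟨ rename-cong pointwise W ⟩
  rename ((a +_) ∘ liftVar e k) W               ≡⟨ rename-∘ (a +_) (liftVar e k) W ⟨
  rename (a +_) (rename (liftVar e k) W)        ≡⟨ cong (rename (a +_)) (lift≡rename e k W) ⟨
  rename (a +_) (lift e k W)                    ≡⟨ lift₀≡rename a _ ⟨
  lift 0 a (lift e k W)                         ∎
  where
  open ≡-Reasoning
  pointwise : ∀ j → liftVar (a + e) k (a + j) ≡ a + liftVar e k j
  pointwise j with j <? e
  ... | yes j<e = trans (liftVar-below k (+-monoʳ-< a j<e)) (cong (a +_) (sym (liftVar-below k j<e)))
  ... | no j≮e  = begin
    liftVar (a + e) k (a + j) ≡⟨ liftVar-above k (+-monoʳ-≤ a (≮⇒≥ j≮e)) ⟩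
    k + (a + j)               ≡⟨ +-assoc k a j ⟨
    k + a + j                 ≡⟨ cong (_+ j) (+-comm k a) ⟩
    a + k + j                 ≡⟨ +-assoc a k j ⟩
    a + (k + j)               ≡⟨ cong (a +_) (liftVar-above k (≮⇒≥ j≮e)) ⟨
    a + liftVar e k j         ∎

≔-below : ∀ V → i < d → (d ≔ V) i ≡ lref i
≔-below {zero}  {suc d} V i<d       = refl
≔-below {suc i} {suc d} V (s≤s i<d) = cong (rename suc) (≔-below V i<d)

≔-at : ∀ d V → (d ≔ V) d ≡ lift 0 d V
≔-at zero    V = sym (trans (lift₀≡rename 0 V) (rename-id V))
≔-at (suc d) V = begin
  rename suc ((d ≔ V) d)     ≡⟨ cong (rename suc) (≔-at d V) ⟩
  rename suc (lift 0 d V)    ≡⟨ lift₀≡rename 1 _ ⟨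
  lift 0 1 (lift 0 d V)      ≡⟨ lift₀-lift₀ 1 d V ⟩
  lift 0 (suc d) V           ∎
  where open ≡-Reasoning

≔-above : ∀ V → d ≤ j → (d ≔ V) (suc j) ≡ lref j
≔-above {zero}          V d≤j       = refl
≔-above {suc d} {suc j} V (s≤s d≤j) = cong (rename suc) (≔-above V d≤j)

≔-lift₀-comm : ∀ a e V W → sub (a + e ≔ V) (lift 0 a W) ≡ lift 0 a (sub (e ≔ V) W)
≔-lift₀-comm a e V W = begin
  sub (a + e ≔ V) (lift 0 a W)            ≡⟨ cong (sub (a + e ≔ V)) (lift₀≡rename a W) ⟩
  sub (a + e ≔ V) (rename (a +_) W)       ≡⟨ sub-rename (a + e ≔ V) (a +_) W ⟩
  sub ((a + e ≔ V) ∘ (a +_)) W            ≡⟨ sub-cong (pointwise a) W ⟩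
  sub (rename (a +_) ∘ (e ≔ V)) W         ≡⟨ rename-sub (a +_) (e ≔ V) W ⟨
  rename (a +_) (sub (e ≔ V) W)           ≡⟨ lift₀≡rename a _ ⟨
  lift 0 a (sub (e ≔ V) W)                ∎
  where
  open ≡-Reasoning
  pointwise : ∀ a j → (a + e ≔ V) (a + j) ≡ rename (a +_) ((e ≔ V) j)
  pointwise zero    j = sym (rename-id _)
  pointwise (suc a) j = trans (cong (rename suc) (pointwise a j)) (rename-∘ suc (a +_) _)

≔-lift₀-≤ : ∀ {a} V W → d ≤ a → sub (d ≔ V) (lift 0 (suc a) W) ≡ lift 0 a W
≔-lift₀-≤ {d} {a} V W d≤a = begin
  sub (d ≔ V) (lift 0 (suc a) W)          ≡⟨ cong (sub (d ≔ V)) (lift₀≡rename (suc a) W) ⟩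
  sub (d ≔ V) (rename (suc a +_) W)       ≡⟨ sub-rename (d ≔ V) (suc a +_) W ⟩
  sub ((d ≔ V) ∘ (suc a +_)) W            ≡⟨ sub-cong (λ j → ≔-above V (≤-trans d≤a (m≤m+n a j))) W ⟩
  sub (lref ∘ (a +_)) W                   ≡⟨ lift₀≡sub a W ⟨
  lift 0 a W                              ∎
  where open ≡-Reasoning

≔₀-lift₁-comm : ∀ V U → sub (0 ≔ lift 0 1 V) (lift 1 1 U) ≡ lift 0 1 (sub (0 ≔ V) U)
≔₀-lift₁-comm V U = begin
  sub (0 ≔ lift 0 1 V) (lift 1 1 U)                  ≡⟨ cong (sub (0 ≔ lift 0 1 V)) (lift≡rename 1 1 U) ⟩
  sub (0 ≔ lift 0 1 V) (rename (liftVar 1 1) U)      ≡⟨ sub-rename _ (liftVar 1 1) U ⟩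
  sub ((0 ≔ lift 0 1 V) ∘ liftVar 1 1) U             ≡⟨ sub-cong pointwise U ⟩
  sub (rename suc ∘ (0 ≔ V)) U                       ≡⟨ rename-sub suc (0 ≔ V) U ⟨
  rename suc (sub (0 ≔ V) U)                         ≡⟨ lift₀≡rename 1 _ ⟨
  lift 0 1 (sub (0 ≔ V) U)                           ∎
  where
  open ≡-Reasoning
  pointwise : (0 ≔ lift 0 1 V) ∘ liftVar 1 1 ≗ rename suc ∘ (0 ≔ V)
  pointwise zero    = lift₀≡rename 1 V
  pointwise (suc j) = refl

SubstS⇒Subst : SubstS i X T T₁ → Subst i X T T₁
SubstS⇒Subst ss-here        = s-here
SubstS⇒Subst (ss-abst₁ a b) = s-abst (SubstS⇒Subst a) b
SubstS⇒Subst (ss-abst₂ a b) = s-abst a (SubstS⇒Subst b)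
SubstS⇒Subst (ss-abbr₁ a b) = s-abbr (SubstS⇒Subst a) b
SubstS⇒Subst (ss-abbr₂ a b) = s-abbr a (SubstS⇒Subst b)
SubstS⇒Subst (ss-appl₁ a b) = s-appl (SubstS⇒Subst a) b
SubstS⇒Subst (ss-appl₂ a b) = s-appl a (SubstS⇒Subst b)
SubstS⇒Subst (ss-cast₁ a b) = s-cast (SubstS⇒Subst a) b
SubstS⇒Subst (ss-cast₂ a b) = s-cast a (SubstS⇒Subst b)

Subst⇒≡⊎SubstS : Subst i X T T₁ → T ≡ T₁ ⊎ SubstS i X T T₁
Subst⇒≡⊎SubstS s-keep = inj₁ refl
Subst⇒≡⊎SubstS s-here = inj₂ ss-here
Subst⇒≡⊎SubstS (s-abst a b) with Subst⇒≡⊎SubstS a | Subst⇒≡⊎SubstS b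
... | inj₁ refl | inj₁ refl = inj₁ refl
... | inj₂ a′   | _         = inj₂ (ss-abst₁ a′ b)
... | inj₁ refl | inj₂ b′   = inj₂ (ss-abst₂ a b′)
Subst⇒≡⊎SubstS (s-abbr a b) with Subst⇒≡⊎SubstS a | Subst⇒≡⊎SubstS b
... | inj₁ refl | inj₁ refl = inj₁ refl
... | inj₂ a′   | _         = inj₂ (ss-abbr₁ a′ b)
... | inj₁ refl | inj₂ b′   = inj₂ (ss-abbr₂ a b′)
Subst⇒≡⊎SubstS (s-appl a b) with Subst⇒≡⊎SubstS a | Subst⇒≡⊎SubstS b
... | inj₁ refl | inj₁ refl = inj₁ refl
... | inj₂ a′   | _         = inj₂ (ss-appl₁ a′ b)
... | inj₁ refl | inj₂ b′   = inj₂ (ss-appl₂ a b′)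
Subst⇒≡⊎SubstS (s-cast a b) with Subst⇒≡⊎SubstS a | Subst⇒≡⊎SubstS b
... | inj₁ refl | inj₁ refl = inj₁ refl
... | inj₂ a′   | _         = inj₂ (ss-cast₁ a′ b)
... | inj₁ refl | inj₂ b′   = inj₂ (ss-cast₂ a b′)

Subst-sub : ∀ σ → σ i ≡ lref j → Subst i X T T₁ → Subst j (sub σ X) (sub σ T) (sub σ T₁)
Subst-sub σ σi s-keep = s-keep
Subst-sub σ σi s-here rewrite σi = s-here
Subst-sub {X = X} σ σi (s-abst a b) = s-abst (Subst-sub σ σi a)
  (subst (λ Y → Subst _ Y _ _) (sub-exts-lift₁ σ X) (Subst-sub (exts σ) (cong (rename suc) σi) b))
Subst-sub {X = X} σ σi (s-abbr a b) = s-abbr (Subst-sub σ σi a)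
  (subst (λ Y → Subst _ Y _ _) (sub-exts-lift₁ σ X) (Subst-sub (exts σ) (cong (rename suc) σi) b))
Subst-sub σ σi (s-appl a b) = s-appl (Subst-sub σ σi a) (Subst-sub σ σi b)
Subst-sub σ σi (s-cast a b) = s-cast (Subst-sub σ σi a) (Subst-sub σ σi b)

SubstS-sub : ∀ σ → σ i ≡ lref j → SubstS i X T T₁ → SubstS j (sub σ X) (sub σ T) (sub σ T₁)
SubstS-sub σ σi ss-here rewrite σi = ss-here
SubstS-sub {X = X} σ σi (ss-abst₁ a b) = ss-abst₁ (SubstS-sub σ σi a)
  (subst (λ Y → Subst _ Y _ _) (sub-exts-lift₁ σ X) (Subst-sub (exts σ) (cong (rename suc) σi) b))
SubstS-sub {X = X} σ σi (ss-abst₂ a b) = ss-abst₂ (Subst-sub σ σi a)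
  (subst (λ Y → SubstS _ Y _ _) (sub-exts-lift₁ σ X) (SubstS-sub (exts σ) (cong (rename suc) σi) b))
SubstS-sub {X = X} σ σi (ss-abbr₁ a b) = ss-abbr₁ (SubstS-sub σ σi a)
  (subst (λ Y → Subst _ Y _ _) (sub-exts-lift₁ σ X) (Subst-sub (exts σ) (cong (rename suc) σi) b))
SubstS-sub {X = X} σ σi (ss-abbr₂ a b) = ss-abbr₂ (Subst-sub σ σi a)
  (subst (λ Y → SubstS _ Y _ _) (sub-exts-lift₁ σ X) (SubstS-sub (exts σ) (cong (rename suc) σi) b))
SubstS-sub σ σi (ss-appl₁ a b) = ss-appl₁ (SubstS-sub σ σi a) (Subst-sub σ σi b)
SubstS-sub σ σi (ss-appl₂ a b) = ss-appl₂ (Subst-sub σ σi a) (SubstS-sub σ σi b)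
SubstS-sub σ σi (ss-cast₁ a b) = ss-cast₁ (SubstS-sub σ σi a) (Subst-sub σ σi b)
SubstS-sub σ σi (ss-cast₂ a b) = ss-cast₂ (Subst-sub σ σi a) (SubstS-sub σ σi b)

SubstS-lift₁ : SubstS i X T T₁ → SubstS (suc i) (lift 0 1 X) (lift 0 1 T) (lift 0 1 T₁)
SubstS-lift₁ {X = X} {T} {T₁} s
  rewrite lift₀≡sub 1 X | lift₀≡sub 1 T | lift₀≡sub 1 T₁ = SubstS-sub (lref ∘ suc) refl s

Subst-lift₁-lift₀ : ∀ {n V T T₁} → Subst (suc n) (lift 0 1 (lift 0 (suc n) V)) T T₁ →
                    Subst (suc n) (lift 0 (suc (suc n)) V) T T₁
Subst-lift₁-lift₀ {n} {V} = subst (λ Y → Subst (suc n) Y _ _) (lift₁-lift₀ (suc n) V)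

IdentityExcept : ℕ → Sub → Set
IdentityExcept i τ = ∀ j → j ≢ i → τ j ≡ lref j

IdentityExcept-exts : ∀ τ → IdentityExcept i τ → IdentityExcept (suc i) (exts τ)
IdentityExcept-exts τ id-off zero    _     = refl
IdentityExcept-exts τ id-off (suc j) j≢1+i = cong (rename suc) (id-off j (j≢1+i ∘ cong suc))

sub⇒Subst : ∀ τ → IdentityExcept i τ → τ i ≡ X → ∀ T → Subst i X T (sub τ T)
sub⇒Subst τ id-off τi (sort h) = s-keep
sub⇒Subst {i} τ id-off τi (lref j) with j ≟ i
... | yes refl = subst (Subst i _ (lref i)) (sym τi) s-here
... | no j≢i   = subst (Subst i _ (lref j)) (sym (id-off j j≢i)) s-keep
sub⇒Subst τ id-off τi (abst W T) =
  s-abst (sub⇒Subst τ id-off τi W) (sub⇒Subst (exts τ) (IdentityExcept-exts τ id-off) τ′i T)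
  where τ′i = trans (cong (rename suc) τi) (sym (lift₀≡rename 1 _))
sub⇒Subst τ id-off τi (abbr V T) =
  s-abbr (sub⇒Subst τ id-off τi V) (sub⇒Subst (exts τ) (IdentityExcept-exts τ id-off) τ′i T)
  where τ′i = trans (cong (rename suc) τi) (sym (lift₀≡rename 1 _))
sub⇒Subst τ id-off τi (appl V T) = s-appl (sub⇒Subst τ id-off τi V) (sub⇒Subst τ id-off τi T)
sub⇒Subst τ id-off τi (cast W T) = s-cast (sub⇒Subst τ id-off τi W) (sub⇒Subst τ id-off τi T)

Subst-≔₀ : ∀ V T → Subst 0 (lift 0 1 V) T (lift 0 1 (sub (0 ≔ V) T))
Subst-≔₀ V T =
  subst (Subst 0 (lift 0 1 V) T) lifted (sub⇒Subst (rename suc ∘ (0 ≔ V)) id-off (sym (lift₀≡rename 1 V)) T)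
  where
  id-off : IdentityExcept 0 (rename suc ∘ (0 ≔ V))
  id-off zero    0≢0 = contradiction refl 0≢0
  id-off (suc j) _   = refl
  lifted : sub (rename suc ∘ (0 ≔ V)) T ≡ lift 0 1 (sub (0 ≔ V) T)
  lifted = trans (sym (rename-sub suc (0 ≔ V) T)) (sym (lift₀≡rename 1 _))

-- Parallel β-reduction and the Church–Rosser property

infix 4 _⇛_ _⇛*_ _≡β_

data _⇛_ : Term → Term → Set where
  p-sort : sort h ⇛ sort h
  p-lref : lref i ⇛ lref i
  p-abst : W ⇛ W′ → T ⇛ T′ → abst W T ⇛ abst W′ T′
  p-abbr : W ⇛ W′ → T ⇛ T′ → abbr W T ⇛ abbr W′ T′
  p-appl : W ⇛ W′ → T ⇛ T′ → appl W T ⇛ appl W′ T′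
  p-cast : W ⇛ W′ → T ⇛ T′ → cast W T ⇛ cast W′ T′
  p-beta : V ⇛ V′ → T ⇛ T′ → appl V (abst W T) ⇛ sub (0 ≔ V′) T′

⇛-refl : ∀ T → T ⇛ T
⇛-refl (sort h)   = p-sort
⇛-refl (lref i)   = p-lref
⇛-refl (abst W T) = p-abst (⇛-refl W) (⇛-refl T)
⇛-refl (abbr V T) = p-abbr (⇛-refl V) (⇛-refl T)
⇛-refl (appl V T) = p-appl (⇛-refl V) (⇛-refl T)
⇛-refl (cast W T) = p-cast (⇛-refl W) (⇛-refl T)

⇛-rename : ∀ ρ → T ⇛ T′ → rename ρ T ⇛ rename ρ T′
⇛-rename ρ p-sort       = p-sort
⇛-rename ρ p-lref       = p-lref
⇛-rename ρ (p-abst a b) = p-abst (⇛-rename ρ a) (⇛-rename (ext ρ) b)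
⇛-rename ρ (p-abbr a b) = p-abbr (⇛-rename ρ a) (⇛-rename (ext ρ) b)
⇛-rename ρ (p-appl a b) = p-appl (⇛-rename ρ a) (⇛-rename ρ b)
⇛-rename ρ (p-cast a b) = p-cast (⇛-rename ρ a) (⇛-rename ρ b)
⇛-rename ρ (p-beta {V′ = V′} {T′ = T′} a b) =
  subst (_ ⇛_) (sym (rename-≔₀ ρ V′ T′)) (p-beta (⇛-rename ρ a) (⇛-rename (ext ρ) b))

_⇛ₛ_ : Sub → Sub → Set
σ ⇛ₛ τ = ∀ i → σ i ⇛ τ i

⇛ₛ-exts : ∀ {σ τ} → σ ⇛ₛ τ → exts σ ⇛ₛ exts τ
⇛ₛ-exts σ⇛τ zero    = p-lref
⇛ₛ-exts σ⇛τ (suc i) = ⇛-rename suc (σ⇛τ i)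

⇛-sub : ∀ {σ τ} → σ ⇛ₛ τ → T ⇛ T′ → sub σ T ⇛ sub τ T′
⇛-sub σ⇛τ p-sort          = p-sort
⇛-sub σ⇛τ (p-lref {i})    = σ⇛τ i
⇛-sub σ⇛τ (p-abst a b)    = p-abst (⇛-sub σ⇛τ a) (⇛-sub (⇛ₛ-exts σ⇛τ) b)
⇛-sub σ⇛τ (p-abbr a b)    = p-abbr (⇛-sub σ⇛τ a) (⇛-sub (⇛ₛ-exts σ⇛τ) b)
⇛-sub σ⇛τ (p-appl a b)    = p-appl (⇛-sub σ⇛τ a) (⇛-sub σ⇛τ b)
⇛-sub σ⇛τ (p-cast a b)    = p-cast (⇛-sub σ⇛τ a) (⇛-sub σ⇛τ b)
⇛-sub {τ = τ} σ⇛τ (p-beta {V′ = V′} {T′ = T′} a b) =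
  subst (_ ⇛_) (sym (sub-≔₀ τ V′ T′)) (p-beta (⇛-sub σ⇛τ a) (⇛-sub (⇛ₛ-exts σ⇛τ) b))

⇛-≔₀ : V ⇛ V′ → T ⇛ T′ → sub (0 ≔ V) T ⇛ sub (0 ≔ V′) T′
⇛-≔₀ V⇛V′ = ⇛-sub σ⇛τ
  where σ⇛τ : (0 ≔ _) ⇛ₛ (0 ≔ _)
        σ⇛τ zero    = V⇛V′
        σ⇛τ (suc i) = p-lref

develop : Term → Term

develop-appl : Term → Term → Term
develop (sort h)   = sort h
develop (lref i)   = lref i
develop (abst W T) = abst (develop W) (develop T)
develop (abbr V T) = abbr (develop V) (develop T)
develop (appl V T) = develop-appl (develop V) T
develop (cast W T) = cast (develop W) (develop T)
develop-appl V (abst W T) = sub (0 ≔ V) (develop T)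
develop-appl V (sort h)   = appl V (sort h)
develop-appl V (lref i)   = appl V (lref i)
develop-appl V (abbr W T) = appl V (abbr (develop W) (develop T))
develop-appl V (appl W T) = appl V (develop-appl (develop W) T)
develop-appl V (cast W T) = appl V (cast (develop W) (develop T))

⇛-develop : T ⇛ T′ → T′ ⇛ develop T
⇛-develop p-sort       = p-sort
⇛-develop p-lref       = p-lref
⇛-develop (p-abst a b) = p-abst (⇛-develop a) (⇛-develop b)
⇛-develop (p-abbr a b) = p-abbr (⇛-develop a) (⇛-develop b)
⇛-develop (p-cast a b) = p-cast (⇛-develop a) (⇛-develop b)
⇛-develop (p-beta a b) = ⇛-≔₀ (⇛-develop a) (⇛-develop b)
⇛-develop (p-appl a p-sort)           = p-appl (⇛-develop a) p-sort
⇛-develop (p-appl a p-lref)           = p-appl (⇛-develop a) p-lref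
⇛-develop (p-appl a (p-abst b c))     = p-beta (⇛-develop a) (⇛-develop c)
⇛-develop (p-appl a (p-abbr b c))     = p-appl (⇛-develop a) (p-abbr (⇛-develop b) (⇛-develop c))
⇛-develop (p-appl a (p-cast b c))     = p-appl (⇛-develop a) (p-cast (⇛-develop b) (⇛-develop c))
⇛-develop (p-appl a b@(p-appl _ _))   = p-appl (⇛-develop a) (⇛-develop b)
⇛-develop (p-appl a b@(p-beta _ _))   = p-appl (⇛-develop a) (⇛-develop b)

data _⇛*_ : Term → Term → Set where
  ⇛*-refl : T ⇛* T
  ⇛*-step : T ⇛ T₁ → T₁ ⇛* T₂ → T ⇛* T₂

⇛*-trans : T ⇛* T₁ → T₁ ⇛* T₂ → T ⇛* T₂
⇛*-trans ⇛*-refl        q = q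
⇛*-trans (⇛*-step a p) q = ⇛*-step a (⇛*-trans p q)

strip : T ⇛ T₁ → T ⇛* T₂ → ∃[ T₃ ] T₁ ⇛* T₃ × T₂ ⇛ T₃
strip {T₁ = T₁} a ⇛*-refl = T₁ , ⇛*-refl , a
strip a (⇛*-step b p) with strip (⇛-develop b) p
... | T₃ , q , c = T₃ , ⇛*-step (⇛-develop a) q , c

⇛*-confluent : T ⇛* T₁ → T ⇛* T₂ → ∃[ T₃ ] T₁ ⇛* T₃ × T₂ ⇛* T₃
⇛*-confluent {T₂ = T₂} ⇛*-refl q = T₂ , q , ⇛*-refl
⇛*-confluent (⇛*-step a p) q with strip a q
... | T₃ , r , c with ⇛*-confluent p r
... | T₄ , s , t = T₄ , s , ⇛*-step c t

data _≡β_ : Term → Term → Set where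
  β-step  : A ⇛ B → A ≡β B
  β-sym   : A ≡β B → B ≡β A
  β-trans : A ≡β B → B ≡β T → A ≡β T

≡β-joinable : A ≡β B → ∃[ T ] A ⇛* T × B ⇛* T
≡β-joinable (β-step {B = B} a) = B , ⇛*-step a ⇛*-refl , ⇛*-refl
≡β-joinable (β-sym p) with ≡β-joinable p
... | T , a , b = T , b , a
≡β-joinable (β-trans p q) with ≡β-joinable p | ≡β-joinable q
... | T₁ , a , b | T₂ , c , d with ⇛*-confluent b c
... | T₃ , e , f = T₃ , ⇛*-trans a e , ⇛*-trans d f

⇛*⇒≡β : A ⇛* B → A ≡β B
⇛*⇒≡β {A} ⇛*-refl      = β-step (⇛-refl A)
⇛*⇒≡β (⇛*-step a p) = β-trans (β-step a) (⇛*⇒≡β p)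

abst-⇛*-inv : abst W U ⇛* T → ∃[ W′ ] ∃[ U′ ] T ≡ abst W′ U′ × W ⇛* W′ × U ⇛* U′
abst-⇛*-inv {W} {U} ⇛*-refl = W , U , refl , ⇛*-refl , ⇛*-refl
abst-⇛*-inv (⇛*-step (p-abst a b) p) with abst-⇛*-inv p
... | W′ , U′ , refl , c , d = W′ , U′ , refl , ⇛*-step a c , ⇛*-step b d

abst-≡β-inv : abst W U ≡β abst W′ U′ → W ≡β W′ × U ≡β U′
abst-≡β-inv p with ≡β-joinable p
... | T , a , b with abst-⇛*-inv a | abst-⇛*-inv b
... | W₂ , U₂ , refl , c , d | W₃ , U₃ , refl , f , g =
  β-trans (⇛*⇒≡β c) (β-sym (⇛*⇒≡β f)) , β-trans (⇛*⇒≡β d) (β-sym (⇛*⇒≡β g))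

-- The index β ∙ C of sp-here is not a constructor pattern; this view exposes it.
data SplitView : Env → Env → Item → ℕ → Set where
  here-abst : SplitView (eabst W C) (esort h) (iabst W) (binders C)
  here-abbr : SplitView (eabbr V C) (esort h) (iabbr V) (binders C)
  in-abst   : Split E D β n → SplitView (eabst W E) (eabst W D) β n
  in-abbr   : Split E D β n → SplitView (eabbr V E) (eabbr V D) β n
  in-appl   : Split E D β n → SplitView (eappl V E) (eappl V D) β n
  in-cast   : Split E D β n → SplitView (ecast W E) (ecast W D) β n

split-view : Split E D β n → SplitView E D β n
split-view (sp-here {β = iabst W}) = here-abst
split-view (sp-here {β = iabbr V}) = here-abbr
split-view (sp-abst s) = in-abst s
split-view (sp-abbr s) = in-abbr s
split-view (sp-appl s) = in-appl s
split-view (sp-cast s) = in-cast s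

sp-here-abst : Split (eabst W C) (esort h) (iabst W) (binders C)
sp-here-abst {W} {C} {h} = sp-here {h = h} {β = iabst W} {C₂ = C}

sp-here-abbr : Split (eabbr V C) (esort h) (iabbr V) (binders C)
sp-here-abbr {V} {C} {h} = sp-here {h = h} {β = iabbr V} {C₂ = C}

¬split-esort : ¬ Split (esort h) D β n
¬split-esort s with split-view s
... | ()

binders-▸ : ∀ E β → binders (E ▸ β) ≡ suc (binders E)
binders-▸ (esort h)   (iabst W) = refl
binders-▸ (esort h)   (iabbr V) = refl
binders-▸ (eabst W E) β = cong suc (binders-▸ E β)
binders-▸ (eabbr V E) β = cong suc (binders-▸ E β)
binders-▸ (eappl V E) β = binders-▸ E β
binders-▸ (ecast W E) β = binders-▸ E β

binders-∙ : ∀ β C → binders (β ∙ C) ≡ suc (binders C)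
binders-∙ (iabst W) C = refl
binders-∙ (iabbr V) C = refl

∙-▸ : ∀ β C γ → (β ∙ C) ▸ γ ≡ β ∙ (C ▸ γ)
∙-▸ (iabst W) C γ = refl
∙-▸ (iabbr V) C γ = refl

sp-∙ : ∀ β → Split C D γ i → Split (β ∙ C) (β ∙ D) γ i
sp-∙ (iabst W) s = sp-abst s
sp-∙ (iabbr V) s = sp-abbr s

split-binders : Split E D β n → binders E ≡ binders D + suc n
split-binders s with split-view s
... | here-abst = refl
... | here-abbr = refl
... | in-abst s′ = cong suc (split-binders s′)
... | in-abbr s′ = cong suc (split-binders s′)
... | in-appl s′ = split-binders s′
... | in-cast s′ = split-binders s′

split-item-unique : Split E D β n → Split E D₁ γ n → β ≡ γ
split-item-unique s t with split-view s | split-view t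
... | here-abst  | here-abst  = refl
... | here-abbr  | here-abbr  = refl
... | here-abst  | in-abst t′ = ⊥-elim (m+1+n≢n _ (sym (split-binders t′)))
... | here-abbr  | in-abbr t′ = ⊥-elim (m+1+n≢n _ (sym (split-binders t′)))
... | in-abst s′ | here-abst  = ⊥-elim (m+1+n≢n _ (sym (split-binders s′)))
... | in-abbr s′ | here-abbr  = ⊥-elim (m+1+n≢n _ (sym (split-binders s′)))
... | in-abst s′ | in-abst t′ = split-item-unique s′ t′
... | in-abbr s′ | in-abbr t′ = split-item-unique s′ t′
... | in-appl s′ | in-appl t′ = split-item-unique s′ t′
... | in-cast s′ | in-cast t′ = split-item-unique s′ t′

split-trans : Split E D β n → Split D D₁ γ m → Split E D₁ γ (suc n + m)
split-trans s t with split-view s | split-view t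
... | here-abst | _ = ⊥-elim (¬split-esort t)
... | here-abbr | _ = ⊥-elim (¬split-esort t)
... | in-abst {D = D} {n = n} s′ | here-abst =
  subst (Split _ _ _) (trans (split-binders s′) (+-comm (binders D) (suc n))) sp-here-abst
... | in-abbr {D = D} {n = n} s′ | here-abbr =
  subst (Split _ _ _) (trans (split-binders s′) (+-comm (binders D) (suc n))) sp-here-abbr
... | in-abst s′ | in-abst t′ = sp-abst (split-trans s′ t′)
... | in-abbr s′ | in-abbr t′ = sp-abbr (split-trans s′ t′)
... | in-appl s′ | in-appl t′ = sp-appl (split-trans s′ t′)
... | in-cast s′ | in-cast t′ = sp-cast (split-trans s′ t′)

split-or-beyond : ∀ E i → (∃[ D ] ∃[ β ] Split E D β i) ⊎ (∃[ j ] i ≡ binders E + j)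
split-or-beyond (esort h) i = inj₂ (i , refl)
split-or-beyond (eabst W E) i with split-or-beyond E i
... | inj₁ (D , β , s)  = inj₁ (eabst W D , β , sp-abst s)
... | inj₂ (zero , eq)  = inj₁ (esort 0 , iabst W , subst (Split _ _ _) (sym (trans eq (+-identityʳ _))) sp-here-abst)
... | inj₂ (suc j , eq) = inj₂ (j , trans eq (+-suc _ _))
split-or-beyond (eabbr V E) i with split-or-beyond E i
... | inj₁ (D , β , s)  = inj₁ (eabbr V D , β , sp-abbr s)
... | inj₂ (zero , eq)  = inj₁ (esort 0 , iabbr V , subst (Split _ _ _) (sym (trans eq (+-identityʳ _))) sp-here-abbr)
... | inj₂ (suc j , eq) = inj₂ (j , trans eq (+-suc _ _))
split-or-beyond (eappl V E) i with split-or-beyond E i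
... | inj₁ (D , β , s) = inj₁ (eappl V D , β , sp-appl s)
... | inj₂ beyond      = inj₂ beyond
split-or-beyond (ecast W E) i with split-or-beyond E i
... | inj₁ (D , β , s) = inj₁ (ecast W D , β , sp-cast s)
... | inj₂ beyond      = inj₂ beyond

size : Env → ℕ
size (esort h)   = 0
size (eabst W E) = suc (size E)
size (eabbr V E) = suc (size E)
size (eappl V E) = suc (size E)
size (ecast W E) = suc (size E)

split-size : Split E D β n → size D < size E
split-size s with split-view s
... | here-abst = s≤s z≤n
... | here-abbr = s≤s z≤n
... | in-abst s′ = s≤s (split-size s′)
... | in-abbr s′ = s≤s (split-size s′)
... | in-appl s′ = s≤s (split-size s′)
... | in-cast s′ = s≤s (split-size s′)

split-▸ : ∀ E β → Split (E ▸ β) E β 0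
split-▸ (esort h)   (iabst W) = sp-here-abst
split-▸ (esort h)   (iabbr V) = sp-here-abbr
split-▸ (eabst W E) β = sp-abst (split-▸ E β)
split-▸ (eabbr V E) β = sp-abbr (split-▸ E β)
split-▸ (eappl V E) β = sp-appl (split-▸ E β)
split-▸ (ecast W E) β = sp-cast (split-▸ E β)

split-▸-suc : ∀ β → Split E D γ n → Split (E ▸ β) D γ (suc n)
split-▸-suc β s with split-view s
... | here-abst {C = C} = subst (Split _ _ _) (binders-▸ C β) sp-here-abst
... | here-abbr {C = C} = subst (Split _ _ _) (binders-▸ C β) sp-here-abbr
... | in-abst s′ = sp-abst (split-▸-suc β s′)
... | in-abbr s′ = sp-abbr (split-▸-suc β s′)
... | in-appl s′ = sp-appl (split-▸-suc β s′)
... | in-cast s′ = sp-cast (split-▸-suc β s′)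

data SameItems : Env → Env → Set where
  same-sort : SameItems (esort h) (esort h₁)
  same-abst : SameItems E E₁ → SameItems (eabst W E) (eabst W E₁)
  same-abbr : SameItems E E₁ → SameItems (eabbr V E) (eabbr V E₁)
  same-appl : SameItems E E₁ → SameItems (eappl V E) (eappl V E₁)
  same-cast : SameItems E E₁ → SameItems (ecast W E) (ecast W E₁)

SameItems-sym : SameItems E E₁ → SameItems E₁ E
SameItems-sym same-sort      = same-sort
SameItems-sym (same-abst ei) = same-abst (SameItems-sym ei)
SameItems-sym (same-abbr ei) = same-abbr (SameItems-sym ei)
SameItems-sym (same-appl ei) = same-appl (SameItems-sym ei)
SameItems-sym (same-cast ei) = same-cast (SameItems-sym ei)

SameItems-binders : SameItems E E₁ → binders E₁ ≡ binders E
SameItems-binders same-sort      = refl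
SameItems-binders (same-abst ei) = cong suc (SameItems-binders ei)
SameItems-binders (same-abbr ei) = cong suc (SameItems-binders ei)
SameItems-binders (same-appl ei) = SameItems-binders ei
SameItems-binders (same-cast ei) = SameItems-binders ei

split-SameItems : SameItems E E₁ → Split E D γ i → Split E₁ D γ i
split-SameItems ei s with ei | split-view s
... | same-abst ei′ | here-abst  = subst (Split _ _ _) (SameItems-binders ei′) sp-here-abst
... | same-abbr ei′ | here-abbr  = subst (Split _ _ _) (SameItems-binders ei′) sp-here-abbr
... | same-abst ei′ | in-abst s′ = sp-abst (split-SameItems ei′ s′)
... | same-abbr ei′ | in-abbr s′ = sp-abbr (split-SameItems ei′ s′)
... | same-appl ei′ | in-appl s′ = sp-appl (split-SameItems ei′ s′)
... | same-cast ei′ | in-cast s′ = sp-cast (split-SameItems ei′ s′)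

SameItems-▸ : ∀ γ → SameItems E E₁ → SameItems (E ▸ γ) (E₁ ▸ γ)
SameItems-▸ (iabst W) same-sort = same-abst same-sort
SameItems-▸ (iabbr V) same-sort = same-abbr same-sort
SameItems-▸ γ (same-abst ei) = same-abst (SameItems-▸ γ ei)
SameItems-▸ γ (same-abbr ei) = same-abbr (SameItems-▸ γ ei)
SameItems-▸ γ (same-appl ei) = same-appl (SameItems-▸ γ ei)
SameItems-▸ γ (same-cast ei) = same-cast (SameItems-▸ γ ei)

-- Splitting off the last item leaves E only up to its terminal sort, which sp-here does not fix.
data Split-▸ (E : Env) (β : Item) (D : Env) : Item → ℕ → Set where
  split-last  : SameItems E D → Split-▸ E β D β 0
  split-inner : Split E D γ m → Split-▸ E β D γ (suc m)

split-▸-inv : ∀ E β → Split (E ▸ β) D γ n → Split-▸ E β D γ n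
split-▸-inv (esort h) (iabst W) s with split-view s
... | here-abst  = split-last same-sort
... | in-abst s′ = ⊥-elim (¬split-esort s′)
split-▸-inv (esort h) (iabbr V) s with split-view s
... | here-abbr  = split-last same-sort
... | in-abbr s′ = ⊥-elim (¬split-esort s′)
split-▸-inv (eabst W E) β s with split-view s
... | here-abst  = subst (Split-▸ _ _ _ _) (sym (binders-▸ E β)) (split-inner sp-here-abst)
... | in-abst s′ with split-▸-inv E β s′
...   | split-last same = split-last (same-abst same)
...   | split-inner s″  = split-inner (sp-abst s″)
split-▸-inv (eabbr V E) β s with split-view s
... | here-abbr  = subst (Split-▸ _ _ _ _) (sym (binders-▸ E β)) (split-inner sp-here-abbr)
... | in-abbr s′ with split-▸-inv E β s′
...   | split-last same = split-last (same-abbr same)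
...   | split-inner s″  = split-inner (sp-abbr s″)
split-▸-inv (eappl V E) β s with split-view s
... | in-appl s′ with split-▸-inv E β s′
...   | split-last same = split-last (same-appl same)
...   | split-inner s″  = split-inner (sp-appl s″)
split-▸-inv (ecast W E) β s with split-view s
... | in-cast s′ with split-▸-inv E β s′
...   | split-last same = split-last (same-cast same)
...   | split-inner s″  = split-inner (sp-cast s″)

split-▸-pred : ∀ γ → Split (E ▸ γ) D β (suc n) → Split E D β n
split-▸-pred {E} γ s with split-▸-inv E γ s
... | split-inner s′ = s′

⇒₀-sub : ∀ σ → A ⇒₀ B → sub σ A ⇒₀ sub σ B
⇒₀-sub σ r-refl       = r-refl
⇒₀-sub σ (r-abst a b) = r-abst (⇒₀-sub σ a) (⇒₀-sub (exts σ) b)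
⇒₀-sub σ (r-abbr a b) = r-abbr (⇒₀-sub σ a) (⇒₀-sub (exts σ) b)
⇒₀-sub σ (r-appl a b) = r-appl (⇒₀-sub σ a) (⇒₀-sub σ b)
⇒₀-sub σ (r-cast a b) = r-cast (⇒₀-sub σ a) (⇒₀-sub σ b)
⇒₀-sub σ (r-beta a b) = r-beta (⇒₀-sub σ a) (⇒₀-sub (exts σ) b)
⇒₀-sub σ (r-delta {V₂ = V₂} a b s) =
  r-delta (⇒₀-sub σ a) (⇒₀-sub (exts σ) b)
          (subst (λ Y → SubstS 0 Y _ _) (sub-exts-lift₁ σ V₂) (SubstS-sub (exts σ) refl s))
⇒₀-sub σ (r-zeta {V} {T₁} {T₂} a) =
  subst (λ Z → abbr (sub σ V) Z ⇒₀ sub σ T₂) (sym (sub-exts-lift₁ σ T₁)) (r-zeta (⇒₀-sub σ a))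
⇒₀-sub σ (r-tau a) = r-tau (⇒₀-sub σ a)
⇒₀-sub σ (r-upsilon {V₁} {V₂} {V₃} {V₄} {T₁} {T₂} a b c) =
  subst (λ Z → sub σ (appl V₁ (abbr V₂ T₁)) ⇒₀ abbr (sub σ V₄) (appl Z (sub (exts σ) T₂)))
        (sym (sub-exts-lift₁ σ V₃))
        (r-upsilon (⇒₀-sub σ a) (⇒₀-sub σ b) (⇒₀-sub (exts σ) c))

⇒₀-lift₁ : A ⇒₀ B → lift 0 1 A ⇒₀ lift 0 1 B
⇒₀-lift₁ {A} {B} r = subst₂ _⇒₀_ (sym (lift₀≡sub 1 A)) (sym (lift₀≡sub 1 B)) (⇒₀-sub (lref ∘ suc) r)

⇔-refl : E ⊢ A ⇔ A
⇔-refl = cv-step (e-free r-refl)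

≡⇒⇔ : A ≡ B → E ⊢ A ⇔ B
≡⇒⇔ refl = ⇔-refl

⇒₀⇒⇔ : A ⇒₀ B → E ⊢ A ⇔ B
⇒₀⇒⇔ r = cv-step (e-free r)

⇔-unfold : Split E D (iabbr V) n → E ⊢ lref n ⇔ lift 0 (suc n) V
⇔-unfold sp = cv-step (e-delta sp r-refl ss-here)

⇔-map : ∀ (f : Term → Term) → (∀ {A B} → E ⊢ A ⇒ B → E₁ ⊢ f A ⇔ f B) → E ⊢ A ⇔ B → E₁ ⊢ f A ⇔ f B
⇔-map f step (cv-step r)    = step r
⇔-map f step (cv-sym p)     = cv-sym (⇔-map f step p)
⇔-map f step (cv-trans p q) = cv-trans (⇔-map f step p) (⇔-map f step q)

⇔-appl₁ : ∀ B → E ⊢ A ⇔ A′ → E ⊢ appl A B ⇔ appl A′ B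
⇔-appl₁ B = ⇔-map (λ Z → appl Z B) λ where
  (e-free r)       → cv-step (e-free (r-appl r r-refl))
  (e-delta sp r s) → cv-step (e-delta sp (r-appl r r-refl) (ss-appl₁ s s-keep))

⇔-appl₂ : ∀ A → E ⊢ B ⇔ B′ → E ⊢ appl A B ⇔ appl A B′
⇔-appl₂ A = ⇔-map (appl A) λ where
  (e-free r)       → cv-step (e-free (r-appl r-refl r))
  (e-delta sp r s) → cv-step (e-delta sp (r-appl r-refl r) (ss-appl₂ s-keep s))

⇔-cast₁ : ∀ B → E ⊢ A ⇔ A′ → E ⊢ cast A B ⇔ cast A′ B
⇔-cast₁ B = ⇔-map (λ Z → cast Z B) λ where
  (e-free r)       → cv-step (e-free (r-cast r r-refl))
  (e-delta sp r s) → cv-step (e-delta sp (r-cast r r-refl) (ss-cast₁ s s-keep))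

⇔-cast₂ : ∀ A → E ⊢ B ⇔ B′ → E ⊢ cast A B ⇔ cast A B′
⇔-cast₂ A = ⇔-map (cast A) λ where
  (e-free r)       → cv-step (e-free (r-cast r-refl r))
  (e-delta sp r s) → cv-step (e-delta sp (r-cast r-refl r) (ss-cast₂ s-keep s))

⇔-abst₁ : ∀ B → E ⊢ A ⇔ A′ → E ⊢ abst A B ⇔ abst A′ B
⇔-abst₁ B = ⇔-map (λ Z → abst Z B) λ where
  (e-free r)       → cv-step (e-free (r-abst r r-refl))
  (e-delta sp r s) → cv-step (e-delta sp (r-abst r r-refl) (ss-abst₁ s s-keep))

⇔-abbr₁ : ∀ B → E ⊢ A ⇔ A′ → E ⊢ abbr A B ⇔ abbr A′ B
⇔-abbr₁ B = ⇔-map (λ Z → abbr Z B) λ where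
  (e-free r)       → cv-step (e-free (r-abbr r r-refl))
  (e-delta sp r s) → cv-step (e-delta sp (r-abbr r r-refl) (ss-abbr₁ s s-keep))

⇔-abst₂ : ∀ A → (E ▸ iabst A) ⊢ B ⇔ B′ → E ⊢ abst A B ⇔ abst A B′
⇔-abst₂ {E} A = ⇔-map (abst A) step
  where
  step : (E ▸ iabst A) ⊢ B ⇒ B′ → E ⊢ abst A B ⇔ abst A B′
  step (e-free r) = cv-step (e-free (r-abst r-refl r))
  step (e-delta {V = V} sp r s) with split-▸-inv E (iabst A) sp
  ... | split-inner {m = m} sp′ =
    cv-step (e-delta sp′ (r-abst r-refl r)
                     (ss-abst₂ s-keep (subst (λ Y → SubstS _ Y _ _) (sym (lift₁-lift₀ (suc m) V)) s)))

⇔-abbr₂ : ∀ A → (E ▸ iabbr A) ⊢ B ⇔ B′ → E ⊢ abbr A B ⇔ abbr A B′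
⇔-abbr₂ {E} A = ⇔-map (abbr A) step
  where
  step : (E ▸ iabbr A) ⊢ B ⇒ B′ → E ⊢ abbr A B ⇔ abbr A B′
  step (e-free r) = cv-step (e-free (r-abbr r-refl r))
  step (e-delta {V = V} sp r s) with split-▸-inv E (iabbr A) sp
  ... | split-last _    = cv-step (e-free (r-delta r-refl r s))
  ... | split-inner {m = m} sp′ =
    cv-step (e-delta sp′ (r-abbr r-refl r)
                     (ss-abbr₂ s-keep (subst (λ Y → SubstS _ Y _ _) (sym (lift₁-lift₀ (suc m) V)) s)))

⇒-lift₁ : ∀ β → E ⊢ A ⇒ B → (E ▸ β) ⊢ lift 0 1 A ⇔ lift 0 1 B
⇒-lift₁ β (e-free r) = cv-step (e-free (⇒₀-lift₁ r))
⇒-lift₁ β (e-delta {V = V} {n = n} sp r s) =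
  cv-step (e-delta (split-▸-suc β sp) (⇒₀-lift₁ r)
                   (subst (λ Y → SubstS _ Y _ _) (lift₁-lift₀ (suc n) V) (SubstS-lift₁ s)))

⇔-lift₁ : ∀ β → E ⊢ A ⇔ B → (E ▸ β) ⊢ lift 0 1 A ⇔ lift 0 1 B
⇔-lift₁ β = ⇔-map (lift 0 1) (⇒-lift₁ β)

⇔-exts : ∀ β σ → E ⊢ σ n ⇔ sub σ X → (E ▸ β) ⊢ exts σ (suc n) ⇔ sub (exts σ) (lift 0 1 X)
⇔-exts {E} {n} {X} β σ σn⇔X =
  subst₂ ((E ▸ β) ⊢_⇔_) (lift₀≡rename 1 (σ n)) (sym (sub-exts-lift₁ σ X)) (⇔-lift₁ β σn⇔X)

⇔-Subst : ∀ σ → Subst n X A A′ → E ⊢ σ n ⇔ sub σ X → E ⊢ sub σ A ⇔ sub σ A′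
⇔-Subst σ s-keep σn⇔X = ⇔-refl
⇔-Subst σ s-here σn⇔X = σn⇔X
⇔-Subst {X = X} σ (s-abst a b) σn⇔X =
  cv-trans (⇔-abst₁ _ (⇔-Subst σ a σn⇔X)) (⇔-abst₂ _ (⇔-Subst (exts σ) b (⇔-exts {X = X} _ σ σn⇔X)))
⇔-Subst {X = X} σ (s-abbr a b) σn⇔X =
  cv-trans (⇔-abbr₁ _ (⇔-Subst σ a σn⇔X)) (⇔-abbr₂ _ (⇔-Subst (exts σ) b (⇔-exts {X = X} _ σ σn⇔X)))
⇔-Subst σ (s-appl a b) σn⇔X = cv-trans (⇔-appl₁ _ (⇔-Subst σ a σn⇔X)) (⇔-appl₂ _ (⇔-Subst σ b σn⇔X))
⇔-Subst σ (s-cast a b) σn⇔X = cv-trans (⇔-cast₁ _ (⇔-Subst σ a σn⇔X)) (⇔-cast₂ _ (⇔-Subst σ b σn⇔X))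

AbbrsPreserved : Sub → Env → Env → Set
AbbrsPreserved σ E E₁ = ∀ {n D V} → Split E D (iabbr V) n → E₁ ⊢ σ n ⇔ sub σ (lift 0 (suc n) V)

⇔-sub : ∀ σ → AbbrsPreserved σ E E₁ → E ⊢ A ⇔ B → E₁ ⊢ sub σ A ⇔ sub σ B
⇔-sub σ preserved = ⇔-map (sub σ) λ where
  (e-free r)       → ⇒₀⇒⇔ (⇒₀-sub σ r)
  (e-delta sp r s) → cv-trans (⇒₀⇒⇔ (⇒₀-sub σ r)) (⇔-Subst σ (SubstS⇒Subst s) (preserved sp))

AbbrsHold : Env → Env → Set
AbbrsHold E E₁ = ∀ {n D V} → Split E D (iabbr V) n → E₁ ⊢ lref n ⇔ lift 0 (suc n) V

⇔-env : AbbrsHold E E₁ → E ⊢ A ⇔ B → E₁ ⊢ A ⇔ B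
⇔-env {E₁ = E₁} {A} {B} hold p =
  subst₂ (E₁ ⊢_⇔_) (sub-id A) (sub-id B) (⇔-sub lref (λ sp → subst (E₁ ⊢ _ ⇔_) (sym (sub-id _)) (hold sp)) p)

⇔-SameItems : SameItems E E₁ → E ⊢ A ⇔ B → E₁ ⊢ A ⇔ B
⇔-SameItems ei = ⇔-env (λ sp → ⇔-unfold (split-SameItems ei sp))

⇔-abst⇒abbr : ∀ W V → (E ▸ iabst W) ⊢ A ⇔ B → (E ▸ iabbr V) ⊢ A ⇔ B
⇔-abst⇒abbr {E} W V = ⇔-env hold
  where hold : AbbrsHold (E ▸ iabst W) (E ▸ iabbr V)
        hold sp with split-▸-inv E (iabst W) sp
        ... | split-inner sp′ = ⇔-unfold (split-▸-suc (iabbr V) sp′)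

⇔-Subst-unfold : Split E D (iabbr V) n → Subst n (lift 0 (suc n) V) A A′ → E ⊢ A ⇔ A′
⇔-Subst-unfold {E} {n = n} {A} {A′} sp s =
  subst₂ (E ⊢_⇔_) (sub-id A) (sub-id A′)
    (⇔-Subst lref s (subst (E ⊢ lref n ⇔_) (sym (sub-id _)) (⇔-unfold sp)))

abbr⇔≔₀ : ∀ V T → E ⊢ abbr V T ⇔ sub (0 ≔ V) T
abbr⇔≔₀ V T with Subst⇒≡⊎SubstS (Subst-≔₀ V T)
... | inj₁ T≡ = cv-trans (≡⇒⇔ (cong (abbr V) T≡)) (⇒₀⇒⇔ (r-zeta r-refl))
... | inj₂ ss = cv-trans (⇒₀⇒⇔ (r-delta r-refl r-refl ss)) (⇒₀⇒⇔ (r-zeta r-refl))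

abbr-▸-⇔ : ∀ E V U → (E ▸ iabbr V) ⊢ lift 0 1 (abbr V U) ⇔ U
abbr-▸-⇔ E V U =
  cv-trans (abbr⇔≔₀ (lift 0 1 V) (lift 1 1 U))
    (cv-trans (≡⇒⇔ (≔₀-lift₁-comm V U)) (cv-sym (⇔-Subst-unfold (split-▸ E (iabbr V)) (Subst-≔₀ V U))))

-- Thinning

liftItem : ℕ → ℕ → Item → Item
liftItem d k (iabst W) = iabst (lift d k W)
liftItem d k (iabbr V) = iabbr (lift d k V)

data Lifted (k : ℕ) : ℕ → Env → Env → Set where
  lifted-sort : Lifted k d (esort h) (esort h₁)
  lifted-abst : Lifted k (suc d) C C₁ → Lifted k d (eabst W C) (eabst (lift d k W) C₁)
  lifted-abbr : Lifted k (suc d) C C₁ → Lifted k d (eabbr V C) (eabbr (lift d k V) C₁)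
  lifted-appl : Lifted k d C C₁ → Lifted k d (eappl V C) (eappl (lift d k V) C₁)
  lifted-cast : Lifted k d C C₁ → Lifted k d (ecast W C) (ecast (lift d k W) C₁)

data Inserted (k : ℕ) : ℕ → Env → Env → Set where
  inserted-none : Lifted k 0 C C₁ → Inserted k 0 C C₁
  inserted-abst : Inserted k m C E₁ → Inserted k (suc m) C (eabst W E₁)
  inserted-abbr : Inserted k m C E₁ → Inserted k (suc m) C (eabbr V E₁)
  inserted-appl : Inserted k m C E₁ → Inserted k m C (eappl V E₁)
  inserted-cast : Inserted k m C E₁ → Inserted k m C (ecast W E₁)

-- E₁ is E with k binders inserted just outside the d innermost binders of E.
data Thinned (k : ℕ) : ℕ → Env → Env → Set where
  thinned-here : Inserted k k C E₁ → d ≡ binders C → Thinned k d C E₁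
  thinned-abst : Thinned k d E E₁ → Thinned k d (eabst W E) (eabst W E₁)
  thinned-abbr : Thinned k d E E₁ → Thinned k d (eabbr V E) (eabbr V E₁)
  thinned-appl : Thinned k d E E₁ → Thinned k d (eappl V E) (eappl V E₁)
  thinned-cast : Thinned k d E E₁ → Thinned k d (ecast W E) (ecast W E₁)

Lifted-binders : Lifted k d C C₁ → binders C₁ ≡ binders C
Lifted-binders lifted-sort     = refl
Lifted-binders (lifted-abst l) = cong suc (Lifted-binders l)
Lifted-binders (lifted-abbr l) = cong suc (Lifted-binders l)
Lifted-binders (lifted-appl l) = Lifted-binders l
Lifted-binders (lifted-cast l) = Lifted-binders l

Inserted-binders : Inserted k m C E₁ → binders E₁ ≡ m + binders C
Inserted-binders (inserted-none l)   = Lifted-binders l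
Inserted-binders (inserted-abst ins) = cong suc (Inserted-binders ins)
Inserted-binders (inserted-abbr ins) = cong suc (Inserted-binders ins)
Inserted-binders (inserted-appl ins) = Inserted-binders ins
Inserted-binders (inserted-cast ins) = Inserted-binders ins

Thinned-binders : Thinned k d E E₁ → binders E₁ ≡ k + binders E × d ≤ binders E
Thinned-binders (thinned-here ins refl) = Inserted-binders ins , ≤-refl
Thinned-binders (thinned-abst th) with Thinned-binders th
... | eq , d≤ = trans (cong suc eq) (sym (+-suc _ _)) , m≤n⇒m≤1+n d≤
Thinned-binders (thinned-abbr th) with Thinned-binders th
... | eq , d≤ = trans (cong suc eq) (sym (+-suc _ _)) , m≤n⇒m≤1+n d≤
Thinned-binders (thinned-appl th) = Thinned-binders th
Thinned-binders (thinned-cast th) = Thinned-binders th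

Lifted-split : Lifted k d C C₁ → Split C D γ i → ∃[ D₁ ] Lifted k d D D₁ × Split C₁ D₁ (liftItem (d + binders D) k γ) i
Lifted-split {k = k} {d = d} {γ = γ} l s with l | split-view s
... | lifted-abst {C₁ = C₁} {W = W} l′ | here-abst {h = h} = esort h , lifted-sort ,
  subst₂ (λ n Z → Split (eabst (lift d k W) C₁) (esort h) (iabst Z) n)
         (Lifted-binders l′) (cong (λ x → lift x k W) (sym (+-identityʳ d))) sp-here-abst
... | lifted-abbr {C₁ = C₁} {V = V} l′ | here-abbr {h = h} = esort h , lifted-sort ,
  subst₂ (λ n Z → Split (eabbr (lift d k V) C₁) (esort h) (iabbr Z) n)
         (Lifted-binders l′) (cong (λ x → lift x k V) (sym (+-identityʳ d))) sp-here-abbr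
... | lifted-abst {C₁ = C₁} l′ | in-abst {D = D} {n = i} s′ with Lifted-split l′ s′
...   | D₁ , l″ , s″ =
  _ , lifted-abst l″ , sp-abst (subst (λ x → Split C₁ D₁ (liftItem x k γ) i) (sym (+-suc d (binders D))) s″)
Lifted-split {k = k} {d = d} {γ = γ} l s | lifted-abbr {C₁ = C₁} l′ | in-abbr {D = D} {n = i} s′
  with Lifted-split l′ s′
...   | D₁ , l″ , s″ =
  _ , lifted-abbr l″ , sp-abbr (subst (λ x → Split C₁ D₁ (liftItem x k γ) i) (sym (+-suc d (binders D))) s″)
Lifted-split {k = k} {d = d} {γ = γ} l s | lifted-appl l′ | in-appl s′ with Lifted-split l′ s′
...   | D₁ , l″ , s″ = _ , lifted-appl l″ , sp-appl s″
Lifted-split {k = k} {d = d} {γ = γ} l s | lifted-cast l′ | in-cast s′ with Lifted-split l′ s′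
...   | D₁ , l″ , s″ = _ , lifted-cast l″ , sp-cast s″

Inserted-split : Inserted k m C E₁ → Split C D γ i → ∃[ D₁ ] Inserted k m D D₁ × Split E₁ D₁ (liftItem (binders D) k γ) i
Inserted-split (inserted-none l) s with Lifted-split l s
... | D₁ , l′ , s′ = D₁ , inserted-none l′ , s′
Inserted-split (inserted-abst ins) s with Inserted-split ins s
... | D₁ , ins′ , s′ = _ , inserted-abst ins′ , sp-abst s′
Inserted-split (inserted-abbr ins) s with Inserted-split ins s
... | D₁ , ins′ , s′ = _ , inserted-abbr ins′ , sp-abbr s′
Inserted-split (inserted-appl ins) s with Inserted-split ins s
... | D₁ , ins′ , s′ = _ , inserted-appl ins′ , sp-appl s′
Inserted-split (inserted-cast ins) s with Inserted-split ins s
... | D₁ , ins′ , s′ = _ , inserted-cast ins′ , sp-cast s′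

data ThinnedSplit (k d : ℕ) (E₁ D : Env) (γ : Item) (i : ℕ) : Set where
  outside : d ≤ i → Split E₁ D γ (k + i) → ThinnedSplit k d E₁ D γ i
  inside  : d ≡ suc (i + e) → Thinned k e D D₁ → Split E₁ D₁ (liftItem e k γ) i → ThinnedSplit k d E₁ D γ i

Thinned-split : Thinned k d E E₁ → Split E D γ i → ThinnedSplit k d E₁ D γ i
Thinned-split th s with th | split-view s
... | thinned-here ins refl | _ with Inserted-split ins s
...   | D₁ , ins′ , s′ = inside (trans (split-binders s) (+-comm _ (suc _))) (thinned-here ins′ refl) s′
Thinned-split th s | thinned-abst th′ | here-abst =
  outside (proj₂ (Thinned-binders th′)) (subst (Split _ _ _) (proj₁ (Thinned-binders th′)) sp-here-abst)
Thinned-split th s | thinned-abbr th′ | here-abbr =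
  outside (proj₂ (Thinned-binders th′)) (subst (Split _ _ _) (proj₁ (Thinned-binders th′)) sp-here-abbr)
Thinned-split th s | thinned-abst th′ | in-abst s′ with Thinned-split th′ s′
...   | outside d≤i s″      = outside d≤i (sp-abst s″)
...   | inside eq th″ s″    = inside eq (thinned-abst th″) (sp-abst s″)
Thinned-split th s | thinned-abbr th′ | in-abbr s′ with Thinned-split th′ s′
...   | outside d≤i s″      = outside d≤i (sp-abbr s″)
...   | inside eq th″ s″    = inside eq (thinned-abbr th″) (sp-abbr s″)
Thinned-split th s | thinned-appl th′ | in-appl s′ with Thinned-split th′ s′
...   | outside d≤i s″      = outside d≤i (sp-appl s″)
...   | inside eq th″ s″    = inside eq (thinned-appl th″) (sp-appl s″)
Thinned-split th s | thinned-cast th′ | in-cast s′ with Thinned-split th′ s′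
...   | outside d≤i s″      = outside d≤i (sp-cast s″)
...   | inside eq th″ s″    = inside eq (thinned-cast th″) (sp-cast s″)

Lifted-▸ : Lifted k d C C₁ → ∀ γ → Lifted k d (C ▸ γ) (C₁ ▸ liftItem (d + binders C) k γ)
Lifted-▸ {k} {d} lifted-sort (iabst W) =
  subst (λ Z → Lifted k d _ (eabst Z _)) (cong (λ x → lift x k W) (sym (+-identityʳ d))) (lifted-abst lifted-sort)
Lifted-▸ {k} {d} lifted-sort (iabbr V) =
  subst (λ Z → Lifted k d _ (eabbr Z _)) (cong (λ x → lift x k V) (sym (+-identityʳ d))) (lifted-abbr lifted-sort)
Lifted-▸ {k} {d} (lifted-abst {C = C} {C₁ = C₁} l) γ =
  lifted-abst (subst (λ x → Lifted k (suc d) (C ▸ γ) (C₁ ▸ liftItem x k γ)) (sym (+-suc d (binders C))) (Lifted-▸ l γ))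
Lifted-▸ {k} {d} (lifted-abbr {C = C} {C₁ = C₁} l) γ =
  lifted-abbr (subst (λ x → Lifted k (suc d) (C ▸ γ) (C₁ ▸ liftItem x k γ)) (sym (+-suc d (binders C))) (Lifted-▸ l γ))
Lifted-▸ (lifted-appl l) γ = lifted-appl (Lifted-▸ l γ)
Lifted-▸ (lifted-cast l) γ = lifted-cast (Lifted-▸ l γ)

Inserted-▸ : Inserted k m C E₁ → ∀ γ → Inserted k m (C ▸ γ) (E₁ ▸ liftItem (binders C) k γ)
Inserted-▸ (inserted-none l)   γ = inserted-none (Lifted-▸ l γ)
Inserted-▸ (inserted-abst ins) γ = inserted-abst (Inserted-▸ ins γ)
Inserted-▸ (inserted-abbr ins) γ = inserted-abbr (Inserted-▸ ins γ)
Inserted-▸ (inserted-appl ins) γ = inserted-appl (Inserted-▸ ins γ)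
Inserted-▸ (inserted-cast ins) γ = inserted-cast (Inserted-▸ ins γ)

Thinned-▸ : Thinned k d E E₁ → ∀ γ → Thinned k (suc d) (E ▸ γ) (E₁ ▸ liftItem d k γ)
Thinned-▸ (thinned-here {C = C} ins refl) γ = thinned-here (Inserted-▸ ins γ) (sym (binders-▸ C γ))
Thinned-▸ (thinned-abst th) γ = thinned-abst (Thinned-▸ th γ)
Thinned-▸ (thinned-abbr th) γ = thinned-abbr (Thinned-▸ th γ)
Thinned-▸ (thinned-appl th) γ = thinned-appl (Thinned-▸ th γ)
Thinned-▸ (thinned-cast th) γ = thinned-cast (Thinned-▸ th γ)

Inserted-esort : ∀ k h C → Inserted k (binders C) (esort h) C
Inserted-esort k h (esort h₁)  = inserted-none lifted-sort
Inserted-esort k h (eabst W C) = inserted-abst (Inserted-esort k h C)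
Inserted-esort k h (eabbr V C) = inserted-abbr (Inserted-esort k h C)
Inserted-esort k h (eappl V C) = inserted-appl (Inserted-esort k h C)
Inserted-esort k h (ecast W C) = inserted-cast (Inserted-esort k h C)

split⇒Thinned : Split E D β n → Thinned (suc n) 0 D E
split⇒Thinned s with split-view s
... | here-abst {W} {C} {h} = thinned-here (Inserted-esort _ h (eabst W C)) refl
... | here-abbr {V} {C} {h} = thinned-here (Inserted-esort _ h (eabbr V C)) refl
... | in-abst s′ = thinned-abst (split⇒Thinned s′)
... | in-abbr s′ = thinned-abbr (split⇒Thinned s′)
... | in-appl s′ = thinned-appl (split⇒Thinned s′)
... | in-cast s′ = thinned-cast (split⇒Thinned s′)

lift-outside : ∀ k W → d ≤ i →
               lift d k (lref i) ≡ lref (k + i) × lift 0 (suc (k + i)) W ≡ lift d k (lift 0 (suc i) W)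
lift-outside {d} {i} k W d≤i =
  trans (lift-lref d k i) (cong lref (liftVar-above k d≤i)) ,
  trans (cong (λ x → lift 0 x W) (sym (+-suc k i))) (sym (lift-lift₀-≤ k W (≤-trans d≤i (n≤1+n i))))

lift-inside : ∀ k e W → lift (suc (i + e)) k (lref i) ≡ lref i ×
                        lift 0 (suc i) (lift e k W) ≡ lift (suc (i + e)) k (lift 0 (suc i) W)
lift-inside {i} k e W =
  trans (lift-lref (suc (i + e)) k i) (cong lref (liftVar-below k (s≤s (m≤m+n i e)))) ,
  sym (lift-lift₀-comm (suc i) e k W)

⇔-thin : Thinned k d E E₁ → E ⊢ A ⇔ B → E₁ ⊢ lift d k A ⇔ lift d k B
⇔-thin {k} {d} {E} {E₁} {A} {B} th p =
  subst₂ (E₁ ⊢_⇔_) (sym (lift≡sub d k A)) (sym (lift≡sub d k B)) (⇔-sub (lref ∘ liftVar d k) preserved p)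
  where
  lifted : ∀ {D V n} → Split E D (iabbr V) n → E₁ ⊢ lift d k (lref n) ⇔ lift d k (lift 0 (suc n) V)
  lifted {V = V} sp with Thinned-split th sp
  ... | outside d≤n sp′ with lift-outside k V d≤n
  ...   | var≡ , abbr≡ = subst₂ (E₁ ⊢_⇔_) (sym var≡) abbr≡ (⇔-unfold sp′)
  lifted {V = V} sp | inside {e = e} refl th′ sp′ with lift-inside k e V
  ...   | var≡ , abbr≡ = subst₂ (E₁ ⊢_⇔_) (sym var≡) abbr≡ (⇔-unfold sp′)
  preserved : AbbrsPreserved (lref ∘ liftVar d k) E E₁
  preserved {n} {D} {V} sp = subst₂ (E₁ ⊢_⇔_) (lift-lref d k n) (lift≡sub d k (lift 0 (suc n) V)) (lifted sp)

⇔-lift-split : Split E D β n → D ⊢ A ⇔ B → E ⊢ lift 0 (suc n) A ⇔ lift 0 (suc n) B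
⇔-lift-split sp = ⇔-thin (split⇒Thinned sp)

⊢-thin : Thinned k d E E₁ → E ⊢[ g ] T ∶ U → E₁ ⊢[ g ] lift d k T ∶ lift d k U
⊢-thin th t-sort = t-sort
⊢-thin {k = k} th (t-def {W = W} sp d) with Thinned-split th sp
... | outside d≤i sp′ with lift-outside k W d≤i
...   | var≡ , type≡ = subst₂ (_ ⊢[ _ ]_∶_) (sym var≡) type≡ (t-def sp′ d)
⊢-thin {k = k} th (t-def {W = W} sp d) | inside {e = e} refl th′ sp′ with lift-inside k e W
...   | var≡ , type≡ = subst₂ (_ ⊢[ _ ]_∶_) (sym var≡) type≡ (t-def sp′ (⊢-thin th′ d))
⊢-thin {k = k} th (t-decl {W = W} sp d) with Thinned-split th sp
... | outside d≤i sp′ with lift-outside k W d≤i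
...   | var≡ , type≡ = subst₂ (_ ⊢[ _ ]_∶_) (sym var≡) type≡ (t-decl sp′ d)
⊢-thin {k = k} th (t-decl {W = W} sp d) | inside {e = e} refl th′ sp′ with lift-inside k e W
...   | var≡ , type≡ = subst₂ (_ ⊢[ _ ]_∶_) (sym var≡) type≡ (t-decl sp′ (⊢-thin th′ d))
⊢-thin th (t-abbr d e)   = t-abbr (⊢-thin th d) (⊢-thin (Thinned-▸ th _) e)
⊢-thin th (t-abst d e)   = t-abst (⊢-thin th d) (⊢-thin (Thinned-▸ th _) e)
⊢-thin th (t-appl d e)   = t-appl (⊢-thin th d) (⊢-thin th e)
⊢-thin th (t-cast d e)   = t-cast (⊢-thin th d) (⊢-thin th e)
⊢-thin th (t-conv d e c) = t-conv (⊢-thin th d) (⊢-thin th e) (⇔-thin th c)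

⊢-lift-split : Split E D β n → D ⊢[ g ] T ∶ U → E ⊢[ g ] lift 0 (suc n) T ∶ lift 0 (suc n) U
⊢-lift-split sp = ⊢-thin (split⇒Thinned sp)

-- Injectivity of abstraction under conversion

expand : Term → Term
expand (sort h)   = sort h
expand (lref i)   = lref i
expand (abst W T) = abst (expand W) (expand T)
expand (abbr V T) = sub (0 ≔ expand V) (expand T)
expand (appl V T) = appl (expand V) (expand T)
expand (cast W T) = expand T

expand-rename : ∀ ρ T → expand (rename ρ T) ≡ rename ρ (expand T)
expand-rename ρ (sort h)   = refl
expand-rename ρ (lref i)   = refl
expand-rename ρ (abst W T) = cong₂ abst (expand-rename ρ W) (expand-rename (ext ρ) T)
expand-rename ρ (abbr V T) =
  trans (cong₂ (λ X Y → sub (0 ≔ X) Y) (expand-rename ρ V) (expand-rename (ext ρ) T))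
        (sym (rename-≔₀ ρ (expand V) (expand T)))
expand-rename ρ (appl V T) = cong₂ appl (expand-rename ρ V) (expand-rename ρ T)
expand-rename ρ (cast W T) = expand-rename ρ T

expand-lift₀ : ∀ k T → expand (lift 0 k T) ≡ lift 0 k (expand T)
expand-lift₀ k T = begin
  expand (lift 0 k T)            ≡⟨ cong expand (lift₀≡rename k T) ⟩
  expand (rename (k +_) T)       ≡⟨ expand-rename (k +_) T ⟩
  rename (k +_) (expand T)       ≡⟨ lift₀≡rename k (expand T) ⟨
  lift 0 k (expand T)            ∎
  where open ≡-Reasoning

≔₀-expand-lift₁ : ∀ X T → sub (0 ≔ X) (expand (lift 0 1 T)) ≡ expand T
≔₀-expand-lift₁ X T = trans (cong (sub (0 ≔ X)) (expand-lift₀ 1 T)) (≔₀-lift₁ X (expand T))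

exts-expand-lift₁ : ∀ σ X → σ i ≡ sub σ (expand X) → exts σ (suc i) ≡ sub (exts σ) (expand (lift 0 1 X))
exts-expand-lift₁ {i} σ X σi = begin
  rename suc (σ i)                       ≡⟨ cong (rename suc) σi ⟩
  rename suc (sub σ (expand X))          ≡⟨ lift₀≡rename 1 _ ⟨
  lift 0 1 (sub σ (expand X))            ≡⟨ sub-exts-lift₁ σ (expand X) ⟨
  sub (exts σ) (lift 0 1 (expand X))     ≡⟨ cong (sub (exts σ)) (expand-lift₀ 1 X) ⟨
  sub (exts σ) (expand (lift 0 1 X))     ∎
  where open ≡-Reasoning

expand-Subst : ∀ σ → σ i ≡ sub σ (expand X) → Subst i X T T₁ → sub σ (expand T) ≡ sub σ (expand T₁)
expand-Subst σ σi s-keep = refl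
expand-Subst σ σi s-here = σi
expand-Subst {X = X} σ σi (s-abst a b) =
  cong₂ abst (expand-Subst σ σi a) (expand-Subst (exts σ) (exts-expand-lift₁ σ X σi) b)
expand-Subst {X = X} σ σi (s-abbr {W = V} {W' = V′} {T = T} {T' = T′} a b) = begin
  sub σ (sub (0 ≔ expand V) (expand T))                 ≡⟨ sub-≔₀ σ (expand V) (expand T) ⟩
  sub (0 ≔ sub σ (expand V)) (sub (exts σ) (expand T))  ≡⟨ cong₂ (λ X Y → sub (0 ≔ X) Y) (expand-Subst σ σi a)
                                                             (expand-Subst (exts σ) (exts-expand-lift₁ σ X σi) b) ⟩
  sub (0 ≔ sub σ (expand V′)) (sub (exts σ) (expand T′)) ≡⟨ sub-≔₀ σ (expand V′) (expand T′) ⟨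
  sub σ (sub (0 ≔ expand V′) (expand T′))               ∎
  where open ≡-Reasoning
expand-Subst σ σi (s-appl a b) = cong₂ appl (expand-Subst σ σi a) (expand-Subst σ σi b)
expand-Subst σ σi (s-cast a b) = expand-Subst σ σi b

expand-⇒₀ : A ⇒₀ B → expand A ⇛ expand B
expand-⇒₀ {A} r-refl   = ⇛-refl (expand A)
expand-⇒₀ (r-abst a b) = p-abst (expand-⇒₀ a) (expand-⇒₀ b)
expand-⇒₀ (r-abbr a b) = ⇛-≔₀ (expand-⇒₀ a) (expand-⇒₀ b)
expand-⇒₀ (r-appl a b) = p-appl (expand-⇒₀ a) (expand-⇒₀ b)
expand-⇒₀ (r-cast a b) = expand-⇒₀ b
expand-⇒₀ (r-beta a b) = p-beta (expand-⇒₀ a) (expand-⇒₀ b)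
expand-⇒₀ (r-delta {V₂ = V₂} a b s) =
  subst (_ ⇛_) (expand-Subst (0 ≔ expand V₂) (sym (≔₀-expand-lift₁ (expand V₂) V₂)) (SubstS⇒Subst s))
        (⇛-≔₀ (expand-⇒₀ a) (expand-⇒₀ b))
expand-⇒₀ (r-zeta {V} {T₁} a) = subst (_⇛ _) (sym (≔₀-expand-lift₁ (expand V) T₁)) (expand-⇒₀ a)
expand-⇒₀ (r-tau a) = expand-⇒₀ a
expand-⇒₀ (r-upsilon {V₃ = V₃} {V₄ = V₄} a b c) =
  subst (λ Z → _ ⇛ appl Z _) (sym (≔₀-expand-lift₁ (expand V₄) V₃))
        (p-appl (expand-⇒₀ a) (⇛-≔₀ (expand-⇒₀ b) (expand-⇒₀ c)))

⇛⇒⇔ : A ⇛ B → E ⊢ A ⇔ B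
⇛⇒⇔ p-sort       = ⇔-refl
⇛⇒⇔ p-lref       = ⇔-refl
⇛⇒⇔ (p-abst a b) = cv-trans (⇔-abst₁ _ (⇛⇒⇔ a)) (⇔-abst₂ _ (⇛⇒⇔ b))
⇛⇒⇔ (p-abbr a b) = cv-trans (⇔-abbr₁ _ (⇛⇒⇔ a)) (⇔-abbr₂ _ (⇛⇒⇔ b))
⇛⇒⇔ (p-appl a b) = cv-trans (⇔-appl₁ _ (⇛⇒⇔ a)) (⇔-appl₂ _ (⇛⇒⇔ b))
⇛⇒⇔ (p-cast a b) = cv-trans (⇔-cast₁ _ (⇛⇒⇔ a)) (⇔-cast₂ _ (⇛⇒⇔ b))
⇛⇒⇔ (p-beta {V′ = V′} {T′ = T′} a b) =
  cv-trans (⇔-appl₁ _ (⇛⇒⇔ a)) (cv-trans (⇔-appl₂ _ (⇔-abst₂ _ (⇛⇒⇔ b)))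
    (cv-trans (⇒₀⇒⇔ (r-beta r-refl r-refl)) (abbr⇔≔₀ V′ T′)))

≡β⇒⇔ : A ≡β B → E ⊢ A ⇔ B
≡β⇒⇔ (β-step a)    = ⇛⇒⇔ a
≡β⇒⇔ (β-sym p)     = cv-sym (≡β⇒⇔ p)
≡β⇒⇔ (β-trans p q) = cv-trans (≡β⇒⇔ p) (≡β⇒⇔ q)

extsAbbr : Sub → Term → Sub
extsAbbr τ X zero    = rename suc X
extsAbbr τ X (suc i) = rename suc (τ i)

-- expandEnv E sends a variable bound in E by δx=V to the expansion of V, with the
-- abbreviations of E preceding it unfolded in turn, and every other variable to itself.
envSub : Env → Sub → Sub
envSub (esort h)   τ = τ
envSub (eabst W E) τ = envSub E (exts τ)
envSub (eabbr V E) τ = envSub E (extsAbbr τ (sub τ (expand V)))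
envSub (eappl V E) τ = envSub E τ
envSub (ecast W E) τ = envSub E τ

expandEnv : Env → Sub
expandEnv E = envSub E lref

envSub-▸-abst : ∀ E W τ → envSub (E ▸ iabst W) τ ≗ exts (envSub E τ)
envSub-▸-abst (esort h)    W τ i = refl
envSub-▸-abst (eabst W₁ E) W τ = envSub-▸-abst E W (exts τ)
envSub-▸-abst (eabbr V E)  W τ = envSub-▸-abst E W _
envSub-▸-abst (eappl V E)  W τ = envSub-▸-abst E W τ
envSub-▸-abst (ecast W₁ E) W τ = envSub-▸-abst E W τ

envSub-beyond : ∀ E τ j → envSub E τ (binders E + j) ≡ rename (binders E +_) (τ j)
envSub-beyond (esort h) τ j = sym (rename-id (τ j))
envSub-beyond (eabst W E) τ j =
  trans (cong (envSub E _) (sym (+-suc (binders E) j)))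
        (trans (envSub-beyond E (exts τ) (suc j)) (rename-+-suc (binders E) (τ j)))
envSub-beyond (eabbr V E) τ j =
  trans (cong (envSub E _) (sym (+-suc (binders E) j)))
        (trans (envSub-beyond E (extsAbbr τ _) (suc j)) (rename-+-suc (binders E) (τ j)))
envSub-beyond (eappl V E) τ j = envSub-beyond E τ j
envSub-beyond (ecast W E) τ j = envSub-beyond E τ j

envSub-abbr : Split E D (iabbr V) n → ∀ τ → envSub E τ n ≡ lift 0 (suc n) (sub (envSub D τ) (expand V))
envSub-abbr s τ with split-view s
... | here-abbr {V} {C} = begin
  envSub C _ (binders C)                                  ≡⟨ cong (envSub C _) (sym (+-identityʳ (binders C))) ⟩
  envSub C _ (binders C + 0)                              ≡⟨ envSub-beyond C _ 0 ⟩
  rename (binders C +_) (rename suc (sub τ (expand V)))   ≡⟨ rename-+-suc (binders C) _ ⟩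
  rename (suc (binders C) +_) (sub τ (expand V))          ≡⟨ lift₀≡rename (suc (binders C)) _ ⟨
  lift 0 (suc (binders C)) (sub τ (expand V))             ∎
  where open ≡-Reasoning
... | in-abst s′ = envSub-abbr s′ (exts τ)
... | in-abbr s′ = envSub-abbr s′ _
... | in-appl s′ = envSub-abbr s′ τ
... | in-cast s′ = envSub-abbr s′ τ

envSub-abst : Split E D (iabst W) n → ∀ τ → envSub E τ n ≡ lref n
envSub-abst s τ with split-view s
... | here-abst {C = C} =
  trans (cong (envSub C _) (sym (+-identityʳ (binders C))))
        (trans (envSub-beyond C _ 0) (cong lref (+-identityʳ (binders C))))
... | in-abst s′ = envSub-abst s′ (exts τ)
... | in-abbr s′ = envSub-abst s′ _
... | in-appl s′ = envSub-abst s′ τ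
... | in-cast s′ = envSub-abst s′ τ

envSub-prefix : Split E D β n → ∀ τ j → envSub E τ (suc n + j) ≡ rename (suc n +_) (envSub D τ j)
envSub-prefix s τ j with split-view s
... | here-abst {C = C} =
  trans (cong (envSub C _) (sym (+-suc (binders C) j)))
        (trans (envSub-beyond C _ (suc j)) (rename-+-suc (binders C) (τ j)))
... | here-abbr {C = C} =
  trans (cong (envSub C _) (sym (+-suc (binders C) j)))
        (trans (envSub-beyond C _ (suc j)) (rename-+-suc (binders C) (τ j)))
... | in-abst s′ = envSub-prefix s′ (exts τ) j
... | in-abbr s′ = envSub-prefix s′ _ j
... | in-appl s′ = envSub-prefix s′ τ j
... | in-cast s′ = envSub-prefix s′ τ j

expandEnv-abbr : ∀ {E D V n} → Split E D (iabbr V) n → expandEnv E n ≡ sub (expandEnv E) (expand (lift 0 (suc n) V))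
expandEnv-abbr {E} {D} {V} {n} sp = sym (begin
  sub (expandEnv E) (expand (lift 0 (suc n) V))            ≡⟨ cong (sub (expandEnv E)) (expand-lift₀ (suc n) V) ⟩
  sub (expandEnv E) (lift 0 (suc n) (expand V))            ≡⟨ cong (sub (expandEnv E)) (lift₀≡rename (suc n) (expand V)) ⟩
  sub (expandEnv E) (rename (suc n +_) (expand V))         ≡⟨ sub-rename (expandEnv E) (suc n +_) (expand V) ⟩
  sub (expandEnv E ∘ (suc n +_)) (expand V)                ≡⟨ sub-cong (envSub-prefix sp lref) (expand V) ⟩
  sub (rename (suc n +_) ∘ expandEnv D) (expand V)         ≡⟨ rename-sub (suc n +_) (expandEnv D) (expand V) ⟨
  rename (suc n +_) (sub (expandEnv D) (expand V))         ≡⟨ lift₀≡rename (suc n) (sub (expandEnv D) (expand V)) ⟨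
  lift 0 (suc n) (sub (expandEnv D) (expand V))            ≡⟨ envSub-abbr sp lref ⟨
  expandEnv E n                                            ∎)
  where open ≡-Reasoning

expandEnv-⇒ : E ⊢ A ⇒ B → sub (expandEnv E) (expand A) ⇛ sub (expandEnv E) (expand B)
expandEnv-⇒ (e-free r) = ⇛-sub (λ i → ⇛-refl _) (expand-⇒₀ r)
expandEnv-⇒ {E} (e-delta sp r s) =
  subst (_ ⇛_) (expand-Subst (expandEnv E) (expandEnv-abbr sp) (SubstS⇒Subst s)) (⇛-sub (λ i → ⇛-refl _) (expand-⇒₀ r))

expandEnv-⇔ : E ⊢ A ⇔ B → sub (expandEnv E) (expand A) ≡β sub (expandEnv E) (expand B)
expandEnv-⇔ (cv-step r)    = β-step (expandEnv-⇒ r)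
expandEnv-⇔ (cv-sym p)     = β-sym (expandEnv-⇔ p)
expandEnv-⇔ (cv-trans p q) = β-trans (expandEnv-⇔ p) (expandEnv-⇔ q)

ExpandEnvSound : Env → Set
ExpandEnvSound E = ∀ i → E ⊢ lref i ⇔ expandEnv E i

ExpandEnvSound-▸-abst : ∀ W → ExpandEnvSound E → ExpandEnvSound (E ▸ iabst W)
ExpandEnvSound-▸-abst {E} W sound zero    = ≡⇒⇔ (sym (envSub-▸-abst E W lref 0))
ExpandEnvSound-▸-abst {E} W sound (suc i) =
  cv-trans (⇔-lift₁ (iabst W) (sound i)) (≡⇒⇔ (trans (lift₀≡rename 1 _) (sym (envSub-▸-abst E W lref (suc i)))))

⇔-expand : ExpandEnvSound E → ∀ A → E ⊢ A ⇔ sub (expandEnv E) (expand A)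

⇔-expand-body : ExpandEnvSound E → ∀ W T → (E ▸ iabst W) ⊢ T ⇔ sub (exts (expandEnv E)) (expand T)

⇔-expand sound (sort h)   = ⇔-refl
⇔-expand sound (lref i)   = sound i
⇔-expand sound (abst W T) = cv-trans (⇔-abst₁ T (⇔-expand sound W)) (⇔-abst₂ _ (⇔-expand-body sound _ T))
⇔-expand {E} sound (abbr V T) =
  cv-trans (⇔-abbr₁ T (⇔-expand sound V))
    (cv-trans (⇔-abbr₂ _ (⇔-abst⇒abbr {E = E} V₁ V₁ (⇔-expand-body sound V₁ T)))
      (cv-trans (abbr⇔≔₀ V₁ _) (≡⇒⇔ (sym (sub-≔₀ (expandEnv E) (expand V) (expand T))))))
  where V₁ = sub (expandEnv E) (expand V)
⇔-expand sound (appl V T) = cv-trans (⇔-appl₁ T (⇔-expand sound V)) (⇔-appl₂ _ (⇔-expand sound T))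
⇔-expand sound (cast W T) = cv-trans (⇒₀⇒⇔ (r-tau r-refl)) (⇔-expand sound T)

⇔-expand-body {E} sound W T =
  cv-trans (⇔-expand (ExpandEnvSound-▸-abst W sound) T) (≡⇒⇔ (sub-cong (envSub-▸-abst E W lref) (expand T)))

expandEnv-sound : ∀ E → ExpandEnvSound E
expandEnv-sound E = sound-acc E (<-wellFounded (size E))
  where
  sound-acc : ∀ E → Acc _<_ (size E) → ExpandEnvSound E
  sound-acc E (acc smaller) i with split-or-beyond E i
  ... | inj₁ (D , iabbr V , sp) =
    cv-trans (⇔-unfold sp)
      (cv-trans (⇔-lift-split sp (⇔-expand (sound-acc D (smaller (split-size sp))) V))
        (≡⇒⇔ (sym (envSub-abbr sp lref))))
  ... | inj₁ (D , iabst W , sp) = ≡⇒⇔ (sym (envSub-abst sp lref))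
  ... | inj₂ (j , refl)         = ≡⇒⇔ (sym (envSub-beyond E lref j))

abst-⇔-inv : E ⊢ abst W U ⇔ abst W′ U′ → E ⊢ W ⇔ W′ × (E ▸ iabst W) ⊢ U ⇔ U′
abst-⇔-inv {E} {W} {U} {W′} {U′} p with abst-≡β-inv (expandEnv-⇔ p)
... | W≡βW′ , U≡βU′ =
  cv-trans (⇔-expand sound W) (cv-trans (≡β⇒⇔ W≡βW′) (cv-sym (⇔-expand sound W′))) ,
  cv-trans (⇔-expand-body sound W U) (cv-trans (≡β⇒⇔ U≡βU′) (cv-sym (⇔-expand-body sound W U′)))
  where sound = expandEnv-sound E

-- Deleting an abbreviation

subItem : ℕ → Term → Item → Item
subItem d V (iabst W) = iabst (sub (d ≔ V) W)
subItem d V (iabbr X) = iabbr (sub (d ≔ V) X)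

data Substituted (V : Term) : ℕ → Env → Env → Set where
  substituted-sort : Substituted V d (esort h) (esort h₁)
  substituted-abst : Substituted V (suc d) C C₁ → Substituted V d (eabst W C) (eabst (sub (d ≔ V) W) C₁)
  substituted-abbr : Substituted V (suc d) C C₁ → Substituted V d (eabbr X C) (eabbr (sub (d ≔ V) X) C₁)
  substituted-appl : Substituted V d C C₁ → Substituted V d (eappl X C) (eappl (sub (d ≔ V) X) C₁)
  substituted-cast : Substituted V d C C₁ → Substituted V d (ecast X C) (ecast (sub (d ≔ V) X) C₁)

-- E₁ is E with its abbreviation δx=V, the (d+1)-th binder from the inside, removed and
-- V substituted for x in the items it scopes over.
data Deleted (V : Term) : ℕ → Env → Env → Set where
  deleted-here : Substituted V 0 C C₁ → d ≡ binders C → Deleted V d (eabbr V C) C₁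
  deleted-abst : Deleted V d E E₁ → Deleted V d (eabst W E) (eabst W E₁)
  deleted-abbr : Deleted V d E E₁ → Deleted V d (eabbr X E) (eabbr X E₁)
  deleted-appl : Deleted V d E E₁ → Deleted V d (eappl X E) (eappl X E₁)
  deleted-cast : Deleted V d E E₁ → Deleted V d (ecast X E) (ecast X E₁)

Substituted-binders : Substituted V d C C₁ → binders C₁ ≡ binders C
Substituted-binders substituted-sort     = refl
Substituted-binders (substituted-abst s) = cong suc (Substituted-binders s)
Substituted-binders (substituted-abbr s) = cong suc (Substituted-binders s)
Substituted-binders (substituted-appl s) = Substituted-binders s
Substituted-binders (substituted-cast s) = Substituted-binders s

Deleted-binders : Deleted V d E E₁ → binders E ≡ suc (binders E₁) × d ≤ binders E₁
Deleted-binders (deleted-here s refl) =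
  cong suc (sym (Substituted-binders s)) , ≤-reflexive (sym (Substituted-binders s))
Deleted-binders (deleted-abst del) with Deleted-binders del
... | eq , d≤ = cong suc eq , m≤n⇒m≤1+n d≤
Deleted-binders (deleted-abbr del) with Deleted-binders del
... | eq , d≤ = cong suc eq , m≤n⇒m≤1+n d≤
Deleted-binders (deleted-appl del) = Deleted-binders del
Deleted-binders (deleted-cast del) = Deleted-binders del

Substituted-split : Substituted V d C C₁ → Split C D γ i →
                    ∃[ D₁ ] Substituted V d D D₁ × Split C₁ D₁ (subItem (d + binders D) V γ) i
Substituted-split {V = V} {d = d} {γ = γ} s sp with s | split-view sp
... | substituted-abst {C₁ = C₁} {W = W} s′ | here-abst {h = h} = esort h , substituted-sort ,
  subst₂ (λ n Z → Split (eabst (sub (d ≔ V) W) C₁) (esort h) (iabst Z) n)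
         (Substituted-binders s′) (cong (λ x → sub (x ≔ V) W) (sym (+-identityʳ d))) sp-here-abst
... | substituted-abbr {C₁ = C₁} {X = X} s′ | here-abbr {h = h} = esort h , substituted-sort ,
  subst₂ (λ n Z → Split (eabbr (sub (d ≔ V) X) C₁) (esort h) (iabbr Z) n)
         (Substituted-binders s′) (cong (λ x → sub (x ≔ V) X) (sym (+-identityʳ d))) sp-here-abbr
... | substituted-abst {C₁ = C₁} s′ | in-abst {D = D} {n = i} sp′ with Substituted-split s′ sp′
...   | D₁ , s″ , sp″ =
  _ , substituted-abst s″ , sp-abst (subst (λ x → Split C₁ D₁ (subItem x V γ) i) (sym (+-suc d (binders D))) sp″)
Substituted-split {V = V} {d = d} {γ = γ} s sp | substituted-abbr {C₁ = C₁} s′ | in-abbr {D = D} {n = i} sp′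
  with Substituted-split s′ sp′
...   | D₁ , s″ , sp″ =
  _ , substituted-abbr s″ , sp-abbr (subst (λ x → Split C₁ D₁ (subItem x V γ) i) (sym (+-suc d (binders D))) sp″)
Substituted-split s sp | substituted-appl s′ | in-appl sp′ with Substituted-split s′ sp′
...   | D₁ , s″ , sp″ = _ , substituted-appl s″ , sp-appl sp″
Substituted-split s sp | substituted-cast s′ | in-cast sp′ with Substituted-split s′ sp′
...   | D₁ , s″ , sp″ = _ , substituted-cast s″ , sp-cast sp″

data DeletedSplit (V : Term) (d : ℕ) (E₁ D : Env) : Item → ℕ → Set where
  deleted : Thinned d 0 D E₁ → DeletedSplit V d E₁ D (iabbr V) d
  inside  : d ≡ suc (i + e) → Deleted V e D D₁ → Split E₁ D₁ (subItem e V γ) i → DeletedSplit V d E₁ D γ i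
  outside : d ≤ j → Split E₁ D γ j → DeletedSplit V d E₁ D γ (suc j)

Deleted-split : Deleted V d E E₁ → Split E D γ i → DeletedSplit V d E₁ D γ i
Deleted-split del sp with del | split-view sp
... | deleted-here {C₁ = C₁} s refl | here-abbr {h = h} =
  deleted (thinned-here (subst (λ x → Inserted x x (esort h) C₁) (Substituted-binders s) (Inserted-esort _ h C₁))
                        refl)
... | deleted-here s refl | in-abbr sp′ with Substituted-split s sp′
...   | D₁ , s′ , sp″ = inside (trans (split-binders sp′) (+-comm _ (suc _))) (deleted-here s′ refl) sp″
Deleted-split del sp | deleted-abst del′ | here-abst with Deleted-binders del′
...   | eq , d≤ = subst (DeletedSplit _ _ _ _ _) (sym eq) (outside d≤ sp-here-abst)
Deleted-split del sp | deleted-abbr del′ | here-abbr with Deleted-binders del′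
...   | eq , d≤ = subst (DeletedSplit _ _ _ _ _) (sym eq) (outside d≤ sp-here-abbr)
Deleted-split del sp | deleted-abst del′ | in-abst sp′ with Deleted-split del′ sp′
...   | deleted th           = deleted (thinned-abst th)
...   | inside eq del″ sp″   = inside eq (deleted-abst del″) (sp-abst sp″)
...   | outside d≤ sp″       = outside d≤ (sp-abst sp″)
Deleted-split del sp | deleted-abbr del′ | in-abbr sp′ with Deleted-split del′ sp′
...   | deleted th           = deleted (thinned-abbr th)
...   | inside eq del″ sp″   = inside eq (deleted-abbr del″) (sp-abbr sp″)
...   | outside d≤ sp″       = outside d≤ (sp-abbr sp″)
Deleted-split del sp | deleted-appl del′ | in-appl sp′ with Deleted-split del′ sp′
...   | deleted th           = deleted (thinned-appl th)
...   | inside eq del″ sp″   = inside eq (deleted-appl del″) (sp-appl sp″)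
...   | outside d≤ sp″       = outside d≤ (sp-appl sp″)
Deleted-split del sp | deleted-cast del′ | in-cast sp′ with Deleted-split del′ sp′
...   | deleted th           = deleted (thinned-cast th)
...   | inside eq del″ sp″   = inside eq (deleted-cast del″) (sp-cast sp″)
...   | outside d≤ sp″       = outside d≤ (sp-cast sp″)

Substituted-▸ : Substituted V d C C₁ → ∀ γ → Substituted V d (C ▸ γ) (C₁ ▸ subItem (d + binders C) V γ)
Substituted-▸ {V} {d} substituted-sort (iabst W) =
  subst (λ Z → Substituted V d _ (eabst Z _)) (cong (λ x → sub (x ≔ V) W) (sym (+-identityʳ d)))
        (substituted-abst substituted-sort)
Substituted-▸ {V} {d} substituted-sort (iabbr X) =
  subst (λ Z → Substituted V d _ (eabbr Z _)) (cong (λ x → sub (x ≔ V) X) (sym (+-identityʳ d)))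
        (substituted-abbr substituted-sort)
Substituted-▸ {V} {d} (substituted-abst {C = C} {C₁ = C₁} s) γ =
  substituted-abst (subst (λ x → Substituted V (suc d) (C ▸ γ) (C₁ ▸ subItem x V γ)) (sym (+-suc d (binders C)))
                          (Substituted-▸ s γ))
Substituted-▸ {V} {d} (substituted-abbr {C = C} {C₁ = C₁} s) γ =
  substituted-abbr (subst (λ x → Substituted V (suc d) (C ▸ γ) (C₁ ▸ subItem x V γ)) (sym (+-suc d (binders C)))
                          (Substituted-▸ s γ))
Substituted-▸ (substituted-appl s) γ = substituted-appl (Substituted-▸ s γ)
Substituted-▸ (substituted-cast s) γ = substituted-cast (Substituted-▸ s γ)

Deleted-▸ : Deleted V d E E₁ → ∀ γ → Deleted V (suc d) (E ▸ γ) (E₁ ▸ subItem d V γ)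
Deleted-▸ (deleted-here {C = C} s refl) γ = deleted-here (Substituted-▸ s γ) (sym (binders-▸ C γ))
Deleted-▸ (deleted-abst del) γ = deleted-abst (Deleted-▸ del γ)
Deleted-▸ (deleted-abbr del) γ = deleted-abbr (Deleted-▸ del γ)
Deleted-▸ (deleted-appl del) γ = deleted-appl (Deleted-▸ del γ)
Deleted-▸ (deleted-cast del) γ = deleted-cast (Deleted-▸ del γ)

Deleted-last : ∀ E V → Deleted V 0 (E ▸ iabbr V) E
Deleted-last (esort h)   V = deleted-here substituted-sort refl
Deleted-last (eabst W E) V = deleted-abst (Deleted-last E V)
Deleted-last (eabbr X E) V = deleted-abbr (Deleted-last E V)
Deleted-last (eappl X E) V = deleted-appl (Deleted-last E V)
Deleted-last (ecast X E) V = deleted-cast (Deleted-last E V)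

≔-inside : ∀ e V W → (suc (i + e) ≔ V) i ≡ lref i ×
                     sub (suc (i + e) ≔ V) (lift 0 (suc i) W) ≡ lift 0 (suc i) (sub (e ≔ V) W)
≔-inside {i} e V W = ≔-below V (s≤s (m≤m+n i e)) , ≔-lift₀-comm (suc i) e V W

≔-outside : ∀ V W → d ≤ j →
            (d ≔ V) (suc j) ≡ lref j × sub (d ≔ V) (lift 0 (suc (suc j)) W) ≡ lift 0 (suc j) W
≔-outside V W d≤j = ≔-above V d≤j , ≔-lift₀-≤ V W (m≤n⇒m≤1+n d≤j)

⇔-delete : Deleted V d E E₁ → E ⊢ A ⇔ B → E₁ ⊢ sub (d ≔ V) A ⇔ sub (d ≔ V) B
⇔-delete {V} {d} {E} {E₁} del = ⇔-sub (d ≔ V) preserved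
  where
  preserved : AbbrsPreserved (d ≔ V) E E₁
  preserved {V = X} sp with Deleted-split del sp
  ... | deleted _ = ≡⇒⇔ (trans (≔-at d V) (sym (≔-lift₀-≤ V V ≤-refl)))
  ... | inside {e = e} refl del′ sp′ with ≔-inside e V X
  ...   | var≡ , abbr≡ = subst₂ (E₁ ⊢_⇔_) (sym var≡) (sym abbr≡) (⇔-unfold sp′)
  preserved {V = X} sp | outside d≤j sp′ with ≔-outside V X d≤j
  ...   | var≡ , abbr≡ = subst₂ (E₁ ⊢_⇔_) (sym var≡) (sym abbr≡) (⇔-unfold sp′)

⊢-delete : Deleted V d E E₁ → E ⊢[ g ] T ∶ U → E₁ ⊢[ g ] sub (d ≔ V) T ∶ sub (d ≔ V) U
⊢-delete del t-sort = t-sort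
⊢-delete {V} {d} del (t-def {W = W} sp t) with Deleted-split del sp
... | deleted th = subst₂ (_ ⊢[ _ ]_∶_) (sym (≔-at d V)) (sym (≔-lift₀-≤ V W ≤-refl)) (⊢-thin th t)
... | inside {e = e} refl del′ sp′ with ≔-inside e V W
...   | var≡ , type≡ = subst₂ (_ ⊢[ _ ]_∶_) (sym var≡) (sym type≡) (t-def sp′ (⊢-delete del′ t))
⊢-delete {V} {d} del (t-def {W = W} sp t) | outside d≤j sp′ with ≔-outside V W d≤j
...   | var≡ , type≡ = subst₂ (_ ⊢[ _ ]_∶_) (sym var≡) (sym type≡) (t-def sp′ t)
⊢-delete {V} {d} del (t-decl {W = W} sp t) with Deleted-split del sp
... | inside {e = e} refl del′ sp′ with ≔-inside e V W
...   | var≡ , type≡ = subst₂ (_ ⊢[ _ ]_∶_) (sym var≡) (sym type≡) (t-decl sp′ (⊢-delete del′ t))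
⊢-delete {V} {d} del (t-decl {W = W} sp t) | outside d≤j sp′ with ≔-outside V W d≤j
...   | var≡ , type≡ = subst₂ (_ ⊢[ _ ]_∶_) (sym var≡) (sym type≡) (t-decl sp′ t)
⊢-delete del (t-abbr t u)   = t-abbr (⊢-delete del t) (⊢-delete (Deleted-▸ del _) u)
⊢-delete del (t-abst t u)   = t-abst (⊢-delete del t) (⊢-delete (Deleted-▸ del _) u)
⊢-delete del (t-appl t u)   = t-appl (⊢-delete del t) (⊢-delete del u)
⊢-delete del (t-cast t u)   = t-cast (⊢-delete del t) (⊢-delete del u)
⊢-delete del (t-conv t u c) = t-conv (⊢-delete del t) (⊢-delete del u) (⇔-delete del c)

⊢-abbr-strengthen : (E ▸ iabbr V) ⊢[ g ] lift 0 1 T ∶ U → E ⊢[ g ] T ∶ sub (0 ≔ V) U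
⊢-abbr-strengthen {E} {V} {T = T} d = subst (E ⊢[ _ ]_∶ _) (≔₀-lift₁ V T) (⊢-delete (Deleted-last E V) d)

-- Replacing an environment item

⊢-SameItems : SameItems E E₁ → E ⊢[ g ] T ∶ U → E₁ ⊢[ g ] T ∶ U
⊢-SameItems ei t-sort          = t-sort
⊢-SameItems ei (t-def sp d)    = t-def (split-SameItems ei sp) d
⊢-SameItems ei (t-decl sp d)   = t-decl (split-SameItems ei sp) d
⊢-SameItems ei (t-abbr d e)    = t-abbr (⊢-SameItems ei d) (⊢-SameItems (SameItems-▸ _ ei) e)
⊢-SameItems ei (t-abst d e)    = t-abst (⊢-SameItems ei d) (⊢-SameItems (SameItems-▸ _ ei) e)
⊢-SameItems ei (t-appl d e)    = t-appl (⊢-SameItems ei d) (⊢-SameItems ei e)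
⊢-SameItems ei (t-cast d e)    = t-cast (⊢-SameItems ei d) (⊢-SameItems ei e)
⊢-SameItems ei (t-conv d e c)  = t-conv (⊢-SameItems ei d) (⊢-SameItems ei e) (⇔-SameItems ei c)

⊢-SameItems-map : (E ⊢[ g ] A ∶ B → E ⊢[ g ] A′ ∶ B) → SameItems E D → D ⊢[ g ] A ∶ B → D ⊢[ g ] A′ ∶ B
⊢-SameItems-map f ei t = ⊢-SameItems ei (f (⊢-SameItems (SameItems-sym ei) t))

data Replaced (β β₁ : Item) : ℕ → Env → Env → Set where
  replaced-here : n ≡ binders C → Replaced β β₁ n (β ∙ C) (β₁ ∙ C)
  replaced-abst : Replaced β β₁ n E E₁ → Replaced β β₁ n (eabst W E) (eabst W E₁)
  replaced-abbr : Replaced β β₁ n E E₁ → Replaced β β₁ n (eabbr V E) (eabbr V E₁)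
  replaced-appl : Replaced β β₁ n E E₁ → Replaced β β₁ n (eappl V E) (eappl V E₁)
  replaced-cast : Replaced β β₁ n E E₁ → Replaced β β₁ n (ecast W E) (ecast W E₁)

Replaced-binders : ∀ {β β₁} → Replaced β β₁ n E E₁ → binders E₁ ≡ binders E × n < binders E
Replaced-binders {β = β} {β₁} (replaced-here {C = C} refl) =
  trans (binders-∙ β₁ C) (sym (binders-∙ β C)) , ≤-reflexive (sym (binders-∙ β C))
Replaced-binders (replaced-abst r) with Replaced-binders r
... | eq , n< = cong suc eq , m≤n⇒m≤1+n n<
Replaced-binders (replaced-abbr r) with Replaced-binders r
... | eq , n< = cong suc eq , m≤n⇒m≤1+n n<
Replaced-binders (replaced-appl r) = Replaced-binders r
Replaced-binders (replaced-cast r) = Replaced-binders r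

data ReplacedSplit (β β₁ : Item) (n : ℕ) (E₁ D : Env) : Item → ℕ → Set where
  replaced : Split E₁ D β₁ n → ReplacedSplit β β₁ n E₁ D β n
  inside   : n ≡ suc (i + e) → Replaced β β₁ e D D₁ → Split E₁ D₁ γ i → ReplacedSplit β β₁ n E₁ D γ i
  outside  : n < i → Split E₁ D γ i → ReplacedSplit β β₁ n E₁ D γ i

Replaced-here-split : ∀ β β₁ C → Split (β ∙ C) D γ i → ReplacedSplit β β₁ (binders C) (β₁ ∙ C) D γ i
Replaced-here-split (iabst W) β₁ C s with split-view s
... | here-abst = replaced sp-here
... | in-abst {D = D} s′ =
  inside (trans (split-binders s′) (+-comm _ (suc _))) (replaced-here refl) (sp-∙ β₁ s′)
Replaced-here-split (iabbr V) β₁ C s with split-view s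
... | here-abbr = replaced sp-here
... | in-abbr {D = D} s′ =
  inside (trans (split-binders s′) (+-comm _ (suc _))) (replaced-here refl) (sp-∙ β₁ s′)

Replaced-split : ∀ {β β₁} → Replaced β β₁ n E E₁ → Split E D γ i → ReplacedSplit β β₁ n E₁ D γ i
Replaced-split {β = β} {β₁} (replaced-here {C = C} refl) s = Replaced-here-split β β₁ C s
Replaced-split (replaced-abst r) s with split-view s
... | here-abst with Replaced-binders r
...   | eq , n< = outside n< (subst (Split _ _ _) eq sp-here-abst)
Replaced-split (replaced-abst r) s | in-abst s′ with Replaced-split r s′
...   | replaced s″        = replaced (sp-abst s″)
...   | inside eq r′ s″    = inside eq (replaced-abst r′) (sp-abst s″)
...   | outside n< s″      = outside n< (sp-abst s″)
Replaced-split (replaced-abbr r) s with split-view s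
... | here-abbr with Replaced-binders r
...   | eq , n< = outside n< (subst (Split _ _ _) eq sp-here-abbr)
Replaced-split (replaced-abbr r) s | in-abbr s′ with Replaced-split r s′
...   | replaced s″        = replaced (sp-abbr s″)
...   | inside eq r′ s″    = inside eq (replaced-abbr r′) (sp-abbr s″)
...   | outside n< s″      = outside n< (sp-abbr s″)
Replaced-split (replaced-appl r) s with split-view s
... | in-appl s′ with Replaced-split r s′
...   | replaced s″        = replaced (sp-appl s″)
...   | inside eq r′ s″    = inside eq (replaced-appl r′) (sp-appl s″)
...   | outside n< s″      = outside n< (sp-appl s″)
Replaced-split (replaced-cast r) s with split-view s
... | in-cast s′ with Replaced-split r s′
...   | replaced s″        = replaced (sp-cast s″)
...   | inside eq r′ s″    = inside eq (replaced-cast r′) (sp-cast s″)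
...   | outside n< s″      = outside n< (sp-cast s″)

Replaced-▸ : ∀ {β β₁} → Replaced β β₁ n E E₁ → ∀ γ → Replaced β β₁ (suc n) (E ▸ γ) (E₁ ▸ γ)
Replaced-▸ {β = β} {β₁} (replaced-here {C = C} refl) γ =
  subst₂ (Replaced β β₁ _) (sym (∙-▸ β C γ)) (sym (∙-▸ β₁ C γ)) (replaced-here (sym (binders-▸ C γ)))
Replaced-▸ (replaced-abst r) γ = replaced-abst (Replaced-▸ r γ)
Replaced-▸ (replaced-abbr r) γ = replaced-abbr (Replaced-▸ r γ)
Replaced-▸ (replaced-appl r) γ = replaced-appl (Replaced-▸ r γ)
Replaced-▸ (replaced-cast r) γ = replaced-cast (Replaced-▸ r γ)

Replaced-last : ∀ E β β₁ → Replaced β β₁ 0 (E ▸ β) (E ▸ β₁)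
Replaced-last (esort h)   β β₁ = replaced-here refl
Replaced-last (eabst W E) β β₁ = replaced-abst (Replaced-last E β β₁)
Replaced-last (eabbr V E) β β₁ = replaced-abbr (Replaced-last E β β₁)
Replaced-last (eappl V E) β β₁ = replaced-appl (Replaced-last E β β₁)
Replaced-last (ecast W E) β β₁ = replaced-cast (Replaced-last E β β₁)

-- The premise of (def), resp. (decl), for typing the variable bound by the item with U.
ItemTyping : (ℕ → ℕ) → Env → Item → Term → Set
ItemTyping g D (iabbr V) U = D ⊢[ g ] V ∶ U
ItemTyping g D (iabst W) U = U ≡ W × ∃[ X ] D ⊢[ g ] W ∶ X

KeepsTypes : (ℕ → ℕ) → Item → Item → Env → ℕ → Set
KeepsTypes g β β₁ E n = ∀ {D U E₂ m} → Split E D β n → ItemTyping g D β U →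
                        Split E₂ D β₁ m → E₂ ⊢[ g ] lref m ∶ lift 0 (suc m) U

KeepsAbbr : Item → Env → ℕ → Set
KeepsAbbr β₁ E n = ∀ {D V E₂ m} → Split E D (iabbr V) n → Split E₂ D β₁ m → E₂ ⊢ lref m ⇔ lift 0 (suc m) V

KeepsTypes-▸ : ∀ {β β₁} γ → KeepsTypes g β β₁ E n → KeepsTypes g β β₁ (E ▸ γ) (suc n)
KeepsTypes-▸ γ keeps s = keeps (split-▸-pred γ s)

KeepsAbbr-▸ : ∀ {β₁} γ → KeepsAbbr β₁ E n → KeepsAbbr β₁ (E ▸ γ) (suc n)
KeepsAbbr-▸ γ keeps s = keeps (split-▸-pred γ s)

KeepsTypes-prefix : ∀ {β β₁} → KeepsTypes g β β₁ E n → Split E D γ i → n ≡ suc (i + e) → KeepsTypes g β β₁ D e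
KeepsTypes-prefix keeps sp refl s = keeps (split-trans sp s)

KeepsAbbr-prefix : ∀ {β₁} → KeepsAbbr β₁ E n → Split E D γ i → n ≡ suc (i + e) → KeepsAbbr β₁ D e
KeepsAbbr-prefix keeps sp refl s = keeps (split-trans sp s)

⇔-replace : ∀ {β β₁ n E E₁ A B} → Replaced β β₁ n E E₁ → KeepsAbbr β₁ E n → E ⊢ A ⇔ B → E₁ ⊢ A ⇔ B
⇔-replace {E = E} {E₁} r keeps = ⇔-env hold
  where
  hold : AbbrsHold E E₁
  hold sp with Replaced-split r sp
  ... | replaced sp′   = keeps sp sp′
  ... | inside _ _ sp′ = ⇔-unfold sp′
  ... | outside _ sp′  = ⇔-unfold sp′

⊢-replace : ∀ {β β₁} → Replaced β β₁ n E E₁ → KeepsTypes g β β₁ E n → KeepsAbbr β₁ E n →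
            E ⊢[ g ] T ∶ U → E₁ ⊢[ g ] T ∶ U
⊢-replace r types abbrs t-sort = t-sort
⊢-replace r types abbrs (t-def sp t) with Replaced-split r sp
... | replaced sp′        = types sp t sp′
... | inside eq r′ sp′    = t-def sp′ (⊢-replace r′ (KeepsTypes-prefix types sp eq) (KeepsAbbr-prefix abbrs sp eq) t)
... | outside _ sp′       = t-def sp′ t
⊢-replace r types abbrs (t-decl sp t) with Replaced-split r sp
... | replaced sp′        = types sp (refl , _ , t) sp′
... | inside eq r′ sp′    = t-decl sp′ (⊢-replace r′ (KeepsTypes-prefix types sp eq) (KeepsAbbr-prefix abbrs sp eq) t)
... | outside _ sp′       = t-decl sp′ t
⊢-replace r types abbrs (t-abbr t u) =
  t-abbr (⊢-replace r types abbrs t) (⊢-replace (Replaced-▸ r _) (KeepsTypes-▸ _ types) (KeepsAbbr-▸ _ abbrs) u)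
⊢-replace r types abbrs (t-abst t u) =
  t-abst (⊢-replace r types abbrs t) (⊢-replace (Replaced-▸ r _) (KeepsTypes-▸ _ types) (KeepsAbbr-▸ _ abbrs) u)
⊢-replace r types abbrs (t-appl t u)   = t-appl (⊢-replace r types abbrs t) (⊢-replace r types abbrs u)
⊢-replace r types abbrs (t-cast t u)   = t-cast (⊢-replace r types abbrs t) (⊢-replace r types abbrs u)
⊢-replace r types abbrs (t-conv t u c) =
  t-conv (⊢-replace r types abbrs t) (⊢-replace r types abbrs u) (⇔-replace r abbrs c)

⊢-replace-abbr : (∀ {W} → E ⊢[ g ] V ∶ W → E ⊢[ g ] V′ ∶ W) → E ⊢ V′ ⇔ V →
                 (E ▸ iabbr V) ⊢[ g ] T ∶ U → (E ▸ iabbr V′) ⊢[ g ] T ∶ U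
⊢-replace-abbr {E} {g} {V} {V′} retype V′⇔V = ⊢-replace (Replaced-last E (iabbr V) (iabbr V′)) keepsTypes keepsAbbr
  where
  keepsTypes : KeepsTypes g (iabbr V) (iabbr V′) (E ▸ iabbr V) 0
  keepsTypes sp t sp′ with split-▸-inv E (iabbr V) sp
  ... | split-last ei = t-def sp′ (⊢-SameItems-map retype ei t)
  keepsAbbr : KeepsAbbr (iabbr V′) (E ▸ iabbr V) 0
  keepsAbbr sp sp′ with split-▸-inv E (iabbr V) sp
  ... | split-last ei = cv-trans (⇔-unfold sp′) (⇔-lift-split sp′ (⇔-SameItems ei V′⇔V))

⊢-replace-abst : (∀ {X} → E ⊢[ g ] W ∶ X → E ⊢[ g ] W′ ∶ X) → E ⊢ W′ ⇔ W →
                 (E ▸ iabst W) ⊢[ g ] T ∶ U → (E ▸ iabst W′) ⊢[ g ] T ∶ U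
⊢-replace-abst {E} {g} {W} {W′} retype W′⇔W = ⊢-replace (Replaced-last E (iabst W) (iabst W′)) keepsTypes keepsAbbr
  where
  keepsTypes : KeepsTypes g (iabst W) (iabst W′) (E ▸ iabst W) 0
  keepsTypes sp (refl , _ , t) sp′ with split-▸-inv E (iabst W) sp
  ... | split-last ei =
    t-conv (⊢-lift-split sp′ t) (t-decl sp′ (⊢-SameItems-map retype ei t)) (⇔-lift-split sp′ (⇔-SameItems ei W′⇔W))
  keepsAbbr : KeepsAbbr (iabst W′) (E ▸ iabst W) 0
  keepsAbbr sp sp′ with split-▸-inv E (iabst W) sp
  ... | ()

⊢-abst⇒abbr : E ⊢[ g ] V ∶ W → (E ▸ iabst W) ⊢[ g ] T ∶ U → (E ▸ iabbr V) ⊢[ g ] T ∶ U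
⊢-abst⇒abbr {E} {g} {V} {W} dV = ⊢-replace (Replaced-last E (iabst W) (iabbr V)) keepsTypes keepsAbbr
  where
  keepsTypes : KeepsTypes g (iabst W) (iabbr V) (E ▸ iabst W) 0
  keepsTypes sp (refl , _ , _) sp′ with split-▸-inv E (iabst W) sp
  ... | split-last ei = t-def sp′ (⊢-SameItems ei dV)
  keepsAbbr : KeepsAbbr (iabbr V) (E ▸ iabst W) 0
  keepsAbbr sp sp′ with split-▸-inv E (iabst W) sp
  ... | ()

⊢-abst-inv : E ⊢[ g ] abst W T ∶ A →
             ∃[ X ] ∃[ U ] E ⊢[ g ] W ∶ X × (E ▸ iabst W) ⊢[ g ] T ∶ U × E ⊢ abst W U ⇔ A
⊢-abst-inv (t-abst dW dT) = _ , _ , dW , dT , ⇔-refl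
⊢-abst-inv (t-conv _ d c) with ⊢-abst-inv d
... | X , U , dW , dT , c′ = X , U , dW , dT , cv-trans c′ c

⊢-abbr-inv : E ⊢[ g ] abbr V T ∶ A →
             ∃[ X ] ∃[ U ] E ⊢[ g ] V ∶ X × (E ▸ iabbr V) ⊢[ g ] T ∶ U × E ⊢ abbr V U ⇔ A
⊢-abbr-inv (t-abbr dV dT) = _ , _ , dV , dT , ⇔-refl
⊢-abbr-inv (t-conv _ d c) with ⊢-abbr-inv d
... | X , U , dV , dT , c′ = X , U , dV , dT , cv-trans c′ c

⊢-valid : E ⊢[ g ] T ∶ U → ∃[ X ] E ⊢[ g ] U ∶ X
⊢-valid t-sort = _ , t-sort
⊢-valid (t-def sp dV) = _ , ⊢-lift-split sp (proj₂ (⊢-valid dV))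
⊢-valid (t-decl sp dW) = _ , ⊢-lift-split sp dW
⊢-valid (t-abbr dV dT) = _ , t-abbr dV (proj₂ (⊢-valid dT))
⊢-valid (t-abst dW dT) = _ , t-abst dW (proj₂ (⊢-valid dT))
⊢-valid (t-appl dV dT) with ⊢-abst-inv (proj₂ (⊢-valid dT))
... | _ , _ , dW , dU , _ = _ , t-appl dV (t-abst dW dU)
⊢-valid (t-cast dT dW) = _ , t-cast dW (proj₂ (⊢-valid dW))
⊢-valid (t-conv dU _ _) = _ , dU

⊢-convert : E ⊢[ g ] T ∶ U → E ⊢[ g ] T₁ ∶ U₁ → E ⊢ U₁ ⇔ U → E ⊢[ g ] T₁ ∶ U
⊢-convert d d₁ c = t-conv (proj₂ (⊢-valid d)) d₁ c

⊢-υ-contractum : E ⊢[ g ] V ∶ W → E ⊢[ g ] V′ ∶ X → (E ▸ iabbr V′) ⊢[ g ] T ∶ U₁ →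
                 E ⊢ abbr V′ U₁ ⇔ abst W U → E ⊢[ g ] abst W U ∶ A →
                 E ⊢[ g ] abbr V′ (appl (lift 0 1 V) T) ∶ abbr V′ (appl (lift 0 1 V) (lift 0 1 (abst W U)))
⊢-υ-contractum {E} {V′ = V′} {U₁ = U₁} dV dV′ dT abbr⇔ dA =
  t-abbr dV′ (t-appl (⊢-lift-split sp dV) (t-conv (⊢-lift-split sp dA) dT U₁⇔))
  where
  sp  = split-▸ E (iabbr V′)
  U₁⇔ = cv-trans (cv-sym (abbr-▸-⇔ E V′ U₁)) (⇔-lift₁ (iabbr V′) abbr⇔)

⊢-Subst-unfold : Split E D (iabbr V) n → Subst n (lift 0 (suc n) V) T T₁ → E ⊢[ g ] T ∶ U → E ⊢[ g ] T₁ ∶ U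
⊢-Subst-unfold sp s (t-conv dU d c) = t-conv dU (⊢-Subst-unfold sp s d) c
⊢-Subst-unfold sp s-keep d = d
⊢-Subst-unfold sp s-here (t-def sp′ dV) with split-item-unique sp sp′
... | refl = ⊢-lift-split sp′ dV
⊢-Subst-unfold sp s-here (t-decl sp′ _) with split-item-unique sp sp′
... | ()
⊢-Subst-unfold {V = V} sp (s-abbr a b) d@(t-abbr dV dT) =
  ⊢-convert d (t-abbr (⊢-Subst-unfold sp a dV)
                      (⊢-replace-abbr (⊢-Subst-unfold sp a) V′⇔V
                                      (⊢-Subst-unfold (split-▸-suc _ sp) (Subst-lift₁-lift₀ {V = V} b) dT)))
              (⇔-abbr₁ _ V′⇔V)
  where V′⇔V = cv-sym (⇔-Subst-unfold sp a)
⊢-Subst-unfold {V = V} sp (s-abst a b) d@(t-abst dW dT) =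
  ⊢-convert d (t-abst (⊢-Subst-unfold sp a dW)
                      (⊢-replace-abst (⊢-Subst-unfold sp a) W′⇔W
                                      (⊢-Subst-unfold (split-▸-suc _ sp) (Subst-lift₁-lift₀ {V = V} b) dT)))
              (⇔-abst₁ _ W′⇔W)
  where W′⇔W = cv-sym (⇔-Subst-unfold sp a)
⊢-Subst-unfold sp (s-appl a b) d@(t-appl dV dT) =
  ⊢-convert d (t-appl (⊢-Subst-unfold sp a dV) (⊢-Subst-unfold sp b dT)) (⇔-appl₁ _ (cv-sym (⇔-Subst-unfold sp a)))
⊢-Subst-unfold sp (s-cast a b) d@(t-cast dT dW) =
  ⊢-convert d (t-cast (t-conv dW′ (⊢-Subst-unfold sp b dT) (⇔-Subst-unfold sp a)) dW′)
              (⇔-cast₂ _ (cv-sym (⇔-Subst-unfold sp a)))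
  where dW′ = ⊢-Subst-unfold sp a dW

⊢-⇒₀ : ∀ {E g T U T₁} → E ⊢[ g ] T ∶ U → T ⇒₀ T₁ → E ⊢[ g ] T₁ ∶ U
⊢-⇒₀ (t-conv dU d c) r = t-conv dU (⊢-⇒₀ d r) c
⊢-⇒₀ d r-refl = d
⊢-⇒₀ {E} d@(t-abbr dV dT) (r-abbr a b) =
  ⊢-convert d (t-abbr (⊢-⇒₀ dV a) (⊢-replace-abbr {E = E} (λ t → ⊢-⇒₀ t a) (cv-sym (⇒₀⇒⇔ a)) (⊢-⇒₀ dT b)))
              (⇔-abbr₁ _ (cv-sym (⇒₀⇒⇔ a)))
⊢-⇒₀ {E} d@(t-abbr dV dT) (r-delta {V₂ = V₂} a b s) =
  ⊢-convert d (t-abbr (⊢-⇒₀ dV a) (⊢-Subst-unfold (split-▸ E (iabbr V₂)) (SubstS⇒Subst s)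
                                     (⊢-replace-abbr {E = E} (λ t → ⊢-⇒₀ t a) (cv-sym (⇒₀⇒⇔ a)) (⊢-⇒₀ dT b))))
              (⇔-abbr₁ _ (cv-sym (⇒₀⇒⇔ a)))
⊢-⇒₀ d@(t-abbr dV dT) (r-zeta a) = ⊢-convert d (⊢-⇒₀ (⊢-abbr-strengthen dT) a) (cv-sym (abbr⇔≔₀ _ _))
⊢-⇒₀ {E} d@(t-abst dW dT) (r-abst a b) =
  ⊢-convert d (t-abst (⊢-⇒₀ dW a) (⊢-replace-abst {E = E} (λ t → ⊢-⇒₀ t a) (cv-sym (⇒₀⇒⇔ a)) (⊢-⇒₀ dT b)))
              (⇔-abst₁ _ (cv-sym (⇒₀⇒⇔ a)))
⊢-⇒₀ d@(t-appl dV dT) (r-appl a b) =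
  ⊢-convert d (t-appl (⊢-⇒₀ dV a) (⊢-⇒₀ dT b)) (⇔-appl₁ _ (cv-sym (⇒₀⇒⇔ a)))
⊢-⇒₀ {E} d@(t-appl {V = V} {U = U} dV dT) (r-beta {V₂ = V₂} {W = W₀} a b) with ⊢-abst-inv dT
... | _ , _ , dW₀ , dT₀ , c with abst-⇔-inv c
... | W₀⇔W , U₀⇔U = ⊢-convert d (t-abbr dV₂ (⊢-abst⇒abbr {E = E} dV₂ (⊢-⇒₀ dT₀ b))) type⇔
  where
  dV₂ = t-conv dW₀ (⊢-⇒₀ dV a) (cv-sym W₀⇔W)
  type⇔ = cv-trans (⇔-abbr₂ V₂ (⇔-abst⇒abbr {E = E} W₀ V₂ U₀⇔U))
            (cv-trans (⇔-abbr₁ U (cv-sym (⇒₀⇒⇔ a))) (cv-sym (⇒₀⇒⇔ (r-beta r-refl r-refl))))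
⊢-⇒₀ {E} d@(t-appl dV dT) (r-upsilon a b c) with ⊢-abbr-inv dT
... | _ , _ , dV₂ , dT₁ , abbr⇔ =
  ⊢-convert d (⊢-υ-contractum (⊢-⇒₀ dV a) (⊢-⇒₀ dV₂ b)
                              (⊢-replace-abbr {E = E} (λ t → ⊢-⇒₀ t b) V₄⇔V₂ (⊢-⇒₀ dT₁ c))
                              (cv-trans (⇔-abbr₁ _ V₄⇔V₂) abbr⇔) (proj₂ (⊢-valid dT)))
              (cv-trans (⇒₀⇒⇔ (r-zeta r-refl)) (⇔-appl₁ _ (cv-sym (⇒₀⇒⇔ a))))
  where V₄⇔V₂ = cv-sym (⇒₀⇒⇔ b)
⊢-⇒₀ d@(t-cast dT dW) (r-cast a b) =
  ⊢-convert d (t-cast (t-conv dW′ (⊢-⇒₀ dT b) (⇒₀⇒⇔ a)) dW′) (⇔-cast₂ _ (cv-sym (⇒₀⇒⇔ a)))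
  where dW′ = ⊢-⇒₀ dW a
⊢-⇒₀ d@(t-cast dT dW) (r-tau a) = ⊢-convert d (⊢-⇒₀ dT a) (cv-sym (⇒₀⇒⇔ (r-tau r-refl)))

⊢-⇒ : E ⊢ T ⇒ T₁ → E ⊢[ g ] T ∶ U → E ⊢[ g ] T₁ ∶ U
⊢-⇒ (e-free r)       d = ⊢-⇒₀ d r
⊢-⇒ (e-delta sp r s) d = ⊢-Subst-unfold sp (SubstS⇒Subst s) (⊢-⇒₀ d r)

⊢-⇒* : E ⊢ T ⇒* T₁ → E ⊢[ g ] T ∶ U → E ⊢[ g ] T₁ ∶ U
⊢-⇒* (st-one r)    d = ⊢-⇒ r d
⊢-⇒* (st-step r p) d = ⊢-⇒* p (⊢-⇒ r d)

mainTheorem4 : (g : ℕ → ℕ) → (∀ h → h < g h) →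
               ∀ (C : Env) (T T₁ T₂ : Term) →
                 C ⊢ T ⇒* T₁ → C ⊢[ g ] T ∶ T₂ → C ⊢[ g ] T₁ ∶ T₂
mainTheorem4 g _ C T T₁ T₂ = ⊢-⇒*
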